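{- Let $n\ge1$, and let $(c_1,\dots,c_{F_{2n}})=\Pi^\beta_{2n}$ be as defined in the context. Order the points of the orbit $e^{ -2\pi i k\varphi}$, $k=1,\dots,F_{2n}$, of $1$ under the circle rotation $z\mapsto z\,e^{ -2\pi i\varphi}$ by increasing angle in $[0,2\pi)$, i.e. list $k_1,\dots,k_{F_{2n}}$ so that $\{ -k_1\varphi\}<\{ -k_2\varphi\}<\dots<\{ -k_{F_{2n}}\varphi\}$ (fractional parts). Then $c_j=k_j-1$ for all $j=1,\dots,F_{2n}$.
   Context: Let $\varphi=(1+\sqrt5)/2$. Every integer $N\ge1$ has a unique base phi expansion $N=\sum_{i\in\mathbb Z} d_i\varphi^i$ with $d_i\in\{0,1\}$, finitely many nonzero, $d_id_{i+1}=0$; with $R$ the smallest index with $d_R=1$, $\beta^-(N)=d_{ -1}\cdots d_R$. Fibonacci numbers $F_0=0,F_1=1$, $F_n=F_{n-1}+F_{n-2}$; Lucas numbers $L_0=2,L_1=1$, $L_n=L_{n-1}+L_{n-2}$; $\Xi_n=[L_{2n-1}+1,L_{2n+1}]$. For a word $e_k\cdots e_0$ over $\{0,1\}$ with no factor $11$, $Z^{ -1}(e_k\cdots e_0)=\sum_i e_iF_{i+2}$ (empty word gives $0$). $\Pi^\beta_{2n}=(c_1,\dots,c_{F_{2n}})$: list the distinct words $\beta^-(N)$, $N\in\Xi_n$, in order of first occurrence as $N$ increases (there are $F_{2n}$ of them), and let $c_j=Z^{ -1}$ of the $j$-th word with its final $01$ removed. (E.g. $\Pi^\beta_4=(2,0,1)$,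 $\Pi^\beta_6=(7,2,5,0,3,6,1,4)$.) -}

module Defs where

open import Data.Nat as ℕ using (ℕ; zero; suc; _∸_)
open import Data.Integer as ℤ using (ℤ; +_; -_)
open import Data.Bool using (Bool; true; false; _∧_)
open import Data.Bool.Properties using () renaming (_≟_ to _≟B_)
open import Data.List using (List; []; _∷_; map; reverse; take; length; upTo; deduplicate; _++_)
open import Data.List.Properties using (≡-dec)
open import Data.List.Relation.Unary.Linked using (Linked)
open import Data.Product using (_×_; ∃₂)
open import Data.Sum using (_⊎_)
open import Relation.Binary.PropositionalEquality using (_≡_)

fib : ℕ → ℕ
fib 0 = 0
fib 1 = 1
fib (suc (suc n)) = fib (suc n) ℕ.+ fib n

lucas : ℕ → ℕ
lucas 0 = 2
lucas 1 = 1
lucas (suc (suc n)) = lucas (suc n) ℕ.+ lucas n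

-- The ring ℤ[φ] ⊂ ℝ: the pair (a , b) denotes the real number a + bφ.
-- Since φ is irrational, equality of such reals is componentwise equality.

infix 5 _+φ*_
record Zφ : Set where
  constructor _+φ*_
  field
    re : ℤ
    im : ℤ
open Zφ public

_⊕_ : Zφ → Zφ → Zφ
(a +φ* b) ⊕ (c +φ* d) = (a ℤ.+ c) +φ* (b ℤ.+ d)

_⊖_ : Zφ → Zφ → Zφ
(a +φ* b) ⊖ (c +φ* d) = (a ℤ.- c) +φ* (b ℤ.- d)

ι : ℤ → Zφ
ι a = a +φ* + 0

-- multiplication by φ  (φ² = φ + 1) and by φ⁻¹ = φ - 1
mulφ : Zφ → Zφ
mulφ (a +φ* b) = b +φ* (a ℤ.+ b)

mulφ⁻¹ : Zφ → Zφ
mulφ⁻¹ (a +φ* b) = (b ℤ.- a) +φ* a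

φ^ : ℕ → Zφ
φ^ zero = + 1 +φ* + 0
φ^ (suc i) = mulφ (φ^ i)

φ^- : ℕ → Zφ
φ^- zero = + 1 +φ* + 0
φ^- (suc i) = mulφ⁻¹ (φ^- i)

-- 0 < x + y√5  (x y : ℤ), decided by comparing squares
Pos√5 : ℤ → ℤ → Set
Pos√5 x y =
    (+ 0 ℤ.≤ x × + 0 ℤ.≤ y × (+ 0 ℤ.< x ⊎ + 0 ℤ.< y))
  ⊎ (x ℤ.< + 0 × + 0 ℤ.< y × x ℤ.* x ℤ.< + 5 ℤ.* (y ℤ.* y))
  ⊎ (+ 0 ℤ.< x × y ℤ.< + 0 × + 5 ℤ.* (y ℤ.* y) ℤ.< x ℤ.* x)

-- 0 < a + bφ  iff  0 < (2a + b) + b√5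
Posφ : Zφ → Set
Posφ (a +φ* b) = Pos√5 (+ 2 ℤ.* a ℤ.+ b) b

_<φ_ : Zφ → Zφ → Set
x <φ y = Posφ (y ⊖ x)

_≤φ_ : Zφ → Zφ → Set
x ≤φ y = x <φ y ⊎ x ≡ y

IsFloor : Zφ → ℤ → Set
IsFloor x m = ι m ≤φ x × x <φ ι (m ℤ.+ + 1)

negKφ : ℕ → Zφ
negKφ k = + 0 +φ* (- (+ k))

-- {-kφ} < {-k'φ}, where {x} = x - ⌊x⌋
FracLt : ℕ → ℕ → Set
FracLt k k' = ∃₂ λ m m' → IsFloor (negKφ k) m × IsFloor (negKφ k') m'
                 × (negKφ k ⊖ ι m) <φ (negKφ k' ⊖ ι m')

-- Base phi expansions.
-- pos = d₀ d₁ … d_m ,  neg = d₋₁ d₋₂ … d₋ᵣ  (all other digits are 0)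

record Expansion : Set where
  constructor mkExp
  field
    pos : List Bool
    neg : List Bool
open Expansion public

sumPos : ℕ → List Bool → Zφ
sumPos i [] = ι (+ 0)
sumPos i (true ∷ ds) = φ^ i ⊕ sumPos (suc i) ds
sumPos i (false ∷ ds) = sumPos (suc i) ds

sumNeg : ℕ → List Bool → Zφ
sumNeg i [] = ι (+ 0)
sumNeg i (true ∷ ds) = φ^- (suc i) ⊕ sumNeg (suc i) ds
sumNeg i (false ∷ ds) = sumNeg (suc i) ds

value : Expansion → Zφ
value e = sumPos 0 (pos e) ⊕ sumNeg 0 (neg e)

No11 : List Bool → Set
No11 = Linked (λ a b → a ∧ b ≡ false)

IsBasePhiExpansion : ℕ → Expansion → Set
IsBasePhiExpansion N e = value e ≡ ι (+ N) × No11 (reverse (neg e) ++ pos e)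

dropFalses : List Bool → List Bool
dropFalses (false ∷ ds) = dropFalses ds
dropFalses ds = ds

-- β⁻(N) = d₋₁ ⋯ d_R  (R the smallest index with d_R = 1)
βminus : Expansion → List Bool
βminus e = reverse (dropFalses (reverse (neg e)))

-- Z⁻¹(e_k ⋯ e₀) = Σ e_i F_{i+2}; the list is written left to right, e₀ last.

Zinv-go : ℕ → List Bool → ℕ
Zinv-go i [] = 0
Zinv-go i (true ∷ bs) = fib (i ℕ.+ 2) ℕ.+ Zinv-go (suc i) bs
Zinv-go i (false ∷ bs) = Zinv-go (suc i) bs

Zinv : List Bool → ℕ
Zinv w = Zinv-go 0 (reverse w)

-- remove the final two letters (the final "01")
dropLast2 : List Bool → List Bool
dropLast2 w = take (length w ∸ 2) w

-- Ξ_n = [L_{2n-1}+1, L_{2n+1}] as an increasing list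
Ξ : ℕ → List ℕ
Ξ n = map (λ i → suc (lucas (2 ℕ.* n ∸ 1)) ℕ.+ i)
          (upTo (lucas (suc (2 ℕ.* n)) ∸ lucas (2 ℕ.* n ∸ 1)))

-- Π^β_{2n}, computed from a choice of expansions exp N
Πβ : ℕ → (ℕ → Expansion) → List ℕ
Πβ n exp = map (λ w → Zinv (dropLast2 w))
               (deduplicate (≡-dec _≟B_) (map (λ N → βminus (exp N)) (Ξ n)))

oneTo : ℕ → List ℕ
oneTo m = map suc (upTo m)

module Submission where

-- Write N ∈ Ξₙ as N = P + v, where P = Σ_{i≥0} dᵢφⁱ ∈ ℤ[φ] is the integer part of its base phi
-- expansion and v = Σ_{i<0} dᵢφⁱ ∈ [0, 1). Bounds on the conjugates of digit sums force the lowest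
-- digit 1 of N to sit at position -2n, followed by a 0, so β⁻(N) = w01 with |w| = 2n - 2, and
-- Y = φ²ⁿv is the value of the digit string β⁻(N) shifted so that its final 1 sits at φ⁰. The label
-- c = Z⁻¹(w) is the φ-coefficient of Y, and {-(c+1)φ} = conj Y - φ⁻¹. Writing P = a + Bφ, the
-- integer B determines the word β⁻(N); along Ξₙ it grows by steps of 0 or 1 from F_{2n-1} to
-- F_{2n+1} - 1, so there are F_{2n} distinct words, met in increasing order of B, and conj Y
-- increases with B. Hence the labels c + 1 enumerate 1, …, F_{2n} in increasing order of {-kφ}.
--
-- Reals a + bφ are compared through the integers aFⱼ + bFⱼ₊₁, the φ-coefficients of (a + bφ)φʲ,
-- which eventually have the sign of a + bφ.

open import Defs
open import Data.Bool using (Bool; true; false)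
open import Data.Bool.Properties using () renaming (_≟_ to _≟ᵇ_)
open import Data.Empty using (⊥; ⊥-elim)
open import Data.Integer as ℤ using (ℤ; +_; -[1+_]; +≤+; +<+)
import Data.Integer.Properties as ℤP
open import Data.Integer.Tactic.RingSolver using (solve-∀)
open import Data.List using (List; []; _∷_; _++_; [_]; map; reverse; length; replicate; take; upTo; applyUpTo; deduplicate; filter)
import Data.List.Properties as ListP
open import Data.List.Properties using (≡-dec)
open import Data.List.Relation.Unary.All as All using (All; []; _∷_)
import Data.List.Relation.Unary.All.Properties as AllP
open import Data.List.Relation.Unary.Any using (here; there)
open import Data.List.Relation.Unary.AllPairs as AllPairs using (AllPairs; []; _∷_)
open import Data.List.Relation.Unary.Linked as Linked using (Linked; []; [-]; _∷_)
import Data.List.Relation.Unary.Linked.Properties as LinkedP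
open import Data.List.Relation.Unary.Unique.Propositional using (Unique)
open import Data.List.Membership.Propositional using (_∈_)
import Data.List.Membership.Propositional.Properties as ∈P
open import Data.List.Relation.Binary.Permutation.Propositional using (_↭_; ↭-sym; ↭-trans; ↭-refl; prep)
import Data.List.Relation.Binary.Permutation.Propositional.Properties as ↭P
open import Data.Nat as ℕ using (ℕ; zero; suc; z≤n; s≤s; _≤_; _∸_; _*_)
import Data.Nat.Properties as ℕP
import Data.Nat.Tactic.RingSolver as ℕSolver
open import Data.Product using (∃; ∃₂; _×_; _,_; proj₁; proj₂)
open import Data.Sum using (_⊎_; inj₁; inj₂)
open import Relation.Binary using (DecidableEquality; tri<; tri≈; tri>)
open import Relation.Binary.PropositionalEquality hiding ([_])
open import Relation.Nullary using (¬_; yes; no)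
open import Relation.Nullary.Decidable using (¬?)

≤-by-nonneg : ∀ {a b : ℤ} (d : ℤ) → + 0 ℤ.≤ d → b ≡ a ℤ.+ d → a ℤ.≤ b
≤-by-nonneg {a} d 0≤d refl = subst (ℤ._≤ a ℤ.+ d) (ℤP.+-identityʳ a) (ℤP.+-monoʳ-≤ a 0≤d)

<-by-pos : ∀ {a b : ℤ} (d : ℤ) → + 0 ℤ.< d → b ≡ a ℤ.+ d → a ℤ.< b
<-by-pos {a} d 0<d refl = subst (ℤ._< a ℤ.+ d) (ℤP.+-identityʳ a) (ℤP.+-monoʳ-< a 0<d)

0≤j-i⇒i≤j : ∀ {a b : ℤ} → + 0 ℤ.≤ b ℤ.- a → a ℤ.≤ b
0≤j-i⇒i≤j {a} {b} h = ≤-by-nonneg (b ℤ.- a) h (identity a b)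
  where identity : ∀ (a b : ℤ) → b ≡ a ℤ.+ (b ℤ.- a)
        identity = solve-∀

i<j⇒0<j-i : ∀ {a b : ℤ} → a ℤ.< b → + 0 ℤ.< b ℤ.- a
i<j⇒0<j-i {a} {b} h = subst (ℤ._< b ℤ.- a) (ℤP.+-inverseʳ a) (ℤP.+-monoˡ-< (ℤ.- a) h)

i<j⇒0≤j-suc[i] : ∀ {x y : ℤ} → x ℤ.< y → + 0 ℤ.≤ y ℤ.- (+ 1 ℤ.+ x)
i<j⇒0≤j-suc[i] x<y = ℤP.i≤j⇒0≤j-i (ℤP.i<j⇒suc[i]≤j x<y)

+-cancelˡ : ∀ a {b c : ℤ} → a ℤ.+ b ≡ a ℤ.+ c → b ≡ c
+-cancelˡ a {b} {c} eq = trans (sym (identity a b)) (trans (cong (ℤ._- a) eq) (identity a c))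
  where identity : ∀ (a b : ℤ) → (a ℤ.+ b) ℤ.- a ≡ b
        identity = solve-∀

0≤-* : ∀ {a b : ℤ} → + 0 ℤ.≤ a → + 0 ℤ.≤ b → + 0 ℤ.≤ a ℤ.* b
0≤-* {+ m} {+ n} _ _ = subst (+ 0 ℤ.≤_) (ℤP.pos-* m n) (+≤+ z≤n)

0<-* : ∀ {a b : ℤ} → + 0 ℤ.< a → + 0 ℤ.< b → + 0 ℤ.< a ℤ.* b
0<-* {+ suc m} {+ suc n} _ _ = +<+ (s≤s z≤n)
0<-* {+ zero} (+<+ ()) _
0<-* {+ suc m} {+ zero} _ (+<+ ())

0≤-square : ∀ (a : ℤ) → + 0 ℤ.≤ a ℤ.* a
0≤-square (+ n) = 0≤-* {+ n} {+ n} (+≤+ z≤n) (+≤+ z≤n)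
0≤-square -[1+ n ] = +≤+ z≤n

*-monoʳ-≤ : ∀ {a b f : ℤ} → + 0 ℤ.≤ f → a ℤ.≤ b → a ℤ.* f ℤ.≤ b ℤ.* f
*-monoʳ-≤ {a} {b} {f} 0≤f a≤b =
  ≤-by-nonneg ((b ℤ.- a) ℤ.* f) (0≤-* (ℤP.i≤j⇒0≤j-i a≤b) 0≤f) (identity a b f)
  where identity : ∀ (a b f : ℤ) → b ℤ.* f ≡ a ℤ.* f ℤ.+ (b ℤ.- a) ℤ.* f
        identity = solve-∀

*-monoʳ-< : ∀ {a b f : ℤ} → + 0 ℤ.< f → a ℤ.< b → a ℤ.* f ℤ.< b ℤ.* f
*-monoʳ-< {a} {b} {f} 0<f a<b =
  <-by-pos ((b ℤ.- a) ℤ.* f) (0<-* (i<j⇒0<j-i a<b) 0<f) (identity a b f)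
  where identity : ∀ (a b f : ℤ) → b ℤ.* f ≡ a ℤ.* f ℤ.+ (b ℤ.- a) ℤ.* f
        identity = solve-∀

-1<i<1⇒i≡0 : ∀ {i : ℤ} → ℤ.- (+ 1) ℤ.< i → i ℤ.< + 1 → i ≡ + 0
-1<i<1⇒i≡0 {+ zero} _ _ = refl
-1<i<1⇒i≡0 {+ suc n} _ (+<+ (s≤s ()))
-1<i<1⇒i≡0 { -[1+ n ]} (ℤ.-<- ()) _

i≤j≤i+1⇒j≡i⊎j≡i+1 : ∀ {a b : ℤ} → a ℤ.≤ b → b ℤ.≤ a ℤ.+ + 1 → b ≡ a ⊎ b ≡ a ℤ.+ + 1
i≤j≤i+1⇒j≡i⊎j≡i+1 {a} {b} a≤b b≤a+1 with b ℤ.≟ a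
... | yes b≡a = inj₁ b≡a
... | no b≢a = inj₂ (ℤP.≤-antisym b≤a+1 (subst (ℤ._≤ b) (ℤP.+-comm (+ 1) a) (ℤP.i<j⇒suc[i]≤j (ℤP.≤∧≢⇒< a≤b (λ a≡b → b≢a (sym a≡b))))))

m<n⇒n∸m≡suc[n∸suc[m]] : ∀ {m n} → m ℕ.< n → n ∸ m ≡ suc (n ∸ suc m)
m<n⇒n∸m≡suc[n∸suc[m]] {zero} {suc n} _ = refl
m<n⇒n∸m≡suc[n∸suc[m]] {suc m} {suc n} (s≤s m<n) = m<n⇒n∸m≡suc[n∸suc[m]] m<n

-- Fibonacci and Lucas numbers

fibℤ : ℕ → ℤ
fibℤ k = + fib k

fibℤ-rec : ∀ k → fibℤ (suc (suc k)) ≡ fibℤ (suc k) ℤ.+ fibℤ k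
fibℤ-rec k = ℤP.pos-+ (fib (suc k)) (fib k)

fib-pos : ∀ k → 0 ℕ.< fib (suc k)
fib-pos zero = s≤s z≤n
fib-pos (suc k) = ℕP.<-≤-trans (fib-pos k) (ℕP.m≤m+n (fib (suc k)) (fib k))

fibℤ-pos : ∀ k → + 0 ℤ.< fibℤ (suc k)
fibℤ-pos k = +<+ (fib-pos k)

fib-≤-suc : ∀ k → fib k ≤ fib (suc k)
fib-≤-suc zero = z≤n
fib-≤-suc (suc zero) = s≤s z≤n
fib-≤-suc (suc (suc k)) = ℕP.m≤m+n (fib (suc (suc k))) (fib (suc k))

fib-mono : ∀ {a b} → a ≤ b → fib a ≤ fib b
fib-mono {a} a≤b with ℕP.m≤n⇒∃[o]m+o≡n a≤b
... | o , refl = go o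
  where
  go : ∀ o → fib a ≤ fib (a ℕ.+ o)
  go zero = ℕP.≤-reflexive (cong fib (sym (ℕP.+-identityʳ a)))
  go (suc o) = ℕP.≤-trans (go o)
    (subst (λ m → fib (a ℕ.+ o) ≤ fib m) (sym (ℕP.+-suc a o)) (fib-≤-suc (a ℕ.+ o)))

fib-<-suc : ∀ k → fib (suc (suc k)) ℕ.< fib (suc (suc (suc k)))
fib-<-suc k = subst (ℕ._< fib (suc (suc k)) ℕ.+ fib (suc k)) (ℕP.+-identityʳ (fib (suc (suc k))))
                (ℕP.+-monoʳ-< (fib (suc (suc k))) (fib-pos k))

n≤fib[2+n] : ∀ k → k ≤ fib (suc (suc k))
n≤fib[2+n] zero = z≤n
n≤fib[2+n] (suc k) = subst (suc k ≤_) (ℕP.+-comm (fib (suc k)) (fib (suc (suc k))))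
                       (ℕP.+-mono-≤ (fib-pos k) (n≤fib[2+n] k))

lucas≡fib+fib : ∀ k → lucas (suc k) ≡ fib k ℕ.+ fib (suc (suc k))
lucas≡fib+fib zero = refl
lucas≡fib+fib (suc zero) = refl
lucas≡fib+fib (suc (suc k)) =
  trans (cong₂ ℕ._+_ (lucas≡fib+fib (suc k)) (lucas≡fib+fib k))
        (identity (fib k) (fib (suc k)) (fib (suc (suc k))) (fib (suc (suc (suc k)))))
  where identity : ∀ (a b c d : ℕ) → (b ℕ.+ d) ℕ.+ (a ℕ.+ c) ≡ (b ℕ.+ a) ℕ.+ (d ℕ.+ c)
        identity = ℕSolver.solve-∀

lucas-suc-pos : ∀ k → 1 ≤ lucas (suc k)
lucas-suc-pos k = subst (1 ≤_) (sym (lucas≡fib+fib k)) (ℕP.≤-trans (fib-pos (suc k)) (ℕP.m≤n+m _ (fib k)))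

double : ℕ → ℕ
double zero = zero
double (suc t) = suc (suc (double t))

double≡2* : ∀ t → double t ≡ 2 * t
double≡2* zero = refl
double≡2* (suc t) = cong suc (trans (cong suc (double≡2* t)) (sym (ℕP.+-suc t (t ℕ.+ 0))))

double-mono : ∀ {a b} → a ≤ b → double a ≤ double b
double-mono {zero} _ = z≤n
double-mono {suc a} {suc b} (s≤s a≤b) = s≤s (s≤s (double-mono a≤b))

even-or-odd : ∀ k → ∃ λ t → k ≡ double t ⊎ k ≡ suc (double t)
even-or-odd zero = 0 , inj₁ refl
even-or-odd (suc k) with even-or-odd k
... | t , inj₁ k≡2t = t , inj₂ (cong suc k≡2t)
... | t , inj₂ k≡2t+1 = suc t , inj₁ (cong suc k≡2t+1)

-- The ring ℤ[φ]

Zφ-≡ : ∀ {x y : Zφ} → re x ≡ re y → im x ≡ im y → x ≡ y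
Zφ-≡ {a +φ* b} {c +φ* d} refl refl = refl

0φ 1φ : Zφ
0φ = ι (+ 0)
1φ = ι (+ 1)

negφ : Zφ → Zφ
negφ (a +φ* b) = (ℤ.- a) +φ* (ℤ.- b)

-- the Galois conjugation φ ↦ 1 - φ
conj : Zφ → Zφ
conj (a +φ* b) = (a ℤ.+ b) +φ* (ℤ.- b)

⊕-identityˡ : ∀ x → 0φ ⊕ x ≡ x
⊕-identityˡ x = Zφ-≡ (ℤP.+-identityˡ (re x)) (ℤP.+-identityˡ (im x))

⊕-identityʳ : ∀ x → x ⊕ 0φ ≡ x
⊕-identityʳ x = Zφ-≡ (ℤP.+-identityʳ (re x)) (ℤP.+-identityʳ (im x))

⊖-identityʳ : ∀ x → x ⊖ 0φ ≡ x
⊖-identityʳ x = Zφ-≡ (ℤP.+-identityʳ (re x)) (ℤP.+-identityʳ (im x))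

⊕-assoc : ∀ x y z → (x ⊕ y) ⊕ z ≡ x ⊕ (y ⊕ z)
⊕-assoc x y z = Zφ-≡ (ℤP.+-assoc (re x) (re y) (re z)) (ℤP.+-assoc (im x) (im y) (im z))

⊕-comm : ∀ x y → x ⊕ y ≡ y ⊕ x
⊕-comm x y = Zφ-≡ (ℤP.+-comm (re x) (re y)) (ℤP.+-comm (im x) (im y))

⊕-cancelˡ : ∀ x {y z} → x ⊕ y ≡ x ⊕ z → y ≡ z
⊕-cancelˡ x eq = Zφ-≡ (+-cancelˡ (re x) (cong re eq)) (+-cancelˡ (im x) (cong im eq))

⊖-⊕-cancel : ∀ x y → (x ⊖ y) ⊕ y ≡ x
⊖-⊕-cancel x y = Zφ-≡ (identity (re x) (re y)) (identity (im x) (im y))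
  where identity : ∀ (a b : ℤ) → (a ℤ.- b) ℤ.+ b ≡ a
        identity = solve-∀

⊖≡0φ⇒≡ : ∀ {x y} → x ⊖ y ≡ 0φ → x ≡ y
⊖≡0φ⇒≡ {x} {y} eq = trans (sym (⊖-⊕-cancel x y)) (trans (cong (_⊕ y) eq) (⊕-identityˡ y))

⊕-⊖-cancel : ∀ x y → (x ⊕ y) ⊖ y ≡ x
⊕-⊖-cancel x y = Zφ-≡ (identity (re x) (re y)) (identity (im x) (im y))
  where identity : ∀ (a b : ℤ) → (a ℤ.+ b) ℤ.- b ≡ a
        identity = solve-∀

negφ-involutive : ∀ x → negφ (negφ x) ≡ x
negφ-involutive x = Zφ-≡ (ℤP.neg-involutive (re x)) (ℤP.neg-involutive (im x))

mulφ-mulφ⁻¹ : ∀ x → mulφ (mulφ⁻¹ x) ≡ x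
mulφ-mulφ⁻¹ x = Zφ-≡ refl (identity (re x) (im x))
  where identity : ∀ (a b : ℤ) → (b ℤ.- a) ℤ.+ a ≡ b
        identity = solve-∀

mulφ⁻¹-mulφ : ∀ x → mulφ⁻¹ (mulφ x) ≡ x
mulφ⁻¹-mulφ x = Zφ-≡ (identity (re x) (im x)) refl
  where identity : ∀ (a b : ℤ) → (a ℤ.+ b) ℤ.- b ≡ a
        identity = solve-∀

mulφ-injective : ∀ {x y} → mulφ x ≡ mulφ y → x ≡ y
mulφ-injective {x} {y} eq = trans (sym (mulφ⁻¹-mulφ x)) (trans (cong mulφ⁻¹ eq) (mulφ⁻¹-mulφ y))

mulφ-⊕ : ∀ x y → mulφ (x ⊕ y) ≡ mulφ x ⊕ mulφ y
mulφ-⊕ x y = Zφ-≡ refl (identity (re x) (im x) (re y) (im y))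
  where identity : ∀ (a b c d : ℤ) → (a ℤ.+ c) ℤ.+ (b ℤ.+ d) ≡ (a ℤ.+ b) ℤ.+ (c ℤ.+ d)
        identity = solve-∀

mulφ-⊖ : ∀ x y → mulφ (x ⊖ y) ≡ mulφ x ⊖ mulφ y
mulφ-⊖ x y = Zφ-≡ refl (identity (re x) (im x) (re y) (im y))
  where identity : ∀ (a b c d : ℤ) → (a ℤ.- c) ℤ.+ (b ℤ.- d) ≡ (a ℤ.+ b) ℤ.- (c ℤ.+ d)
        identity = solve-∀

mulφ⁻¹-⊖ : ∀ x y → mulφ⁻¹ (x ⊖ y) ≡ mulφ⁻¹ x ⊖ mulφ⁻¹ y
mulφ⁻¹-⊖ x y = Zφ-≡ (identity (re x) (im x) (re y) (im y)) refl
  where identity : ∀ (a b c d : ℤ) → (b ℤ.- d) ℤ.- (a ℤ.- c) ≡ (b ℤ.- a) ℤ.- (d ℤ.- c)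
        identity = solve-∀

mulφ⁻¹-negφ : ∀ x → mulφ⁻¹ (negφ x) ≡ negφ (mulφ⁻¹ x)
mulφ⁻¹-negφ x = Zφ-≡ (identity (re x) (im x)) refl
  where identity : ∀ (a b : ℤ) → ℤ.- b ℤ.- ℤ.- a ≡ ℤ.- (b ℤ.- a)
        identity = solve-∀

conj-⊕ : ∀ x y → conj (x ⊕ y) ≡ conj x ⊕ conj y
conj-⊕ x y = Zφ-≡ (identity (re x) (im x) (re y) (im y)) (ℤP.neg-distrib-+ (im x) (im y))
  where identity : ∀ (a b c d : ℤ) → (a ℤ.+ c) ℤ.+ (b ℤ.+ d) ≡ (a ℤ.+ b) ℤ.+ (c ℤ.+ d)
        identity = solve-∀

conj-⊖ : ∀ x y → conj (x ⊖ y) ≡ conj x ⊖ conj y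
conj-⊖ x y = Zφ-≡ (identity₁ (re x) (im x) (re y) (im y)) (identity₂ (im x) (im y))
  where identity₁ : ∀ (a b c d : ℤ) → (a ℤ.- c) ℤ.+ (b ℤ.- d) ≡ (a ℤ.+ b) ℤ.- (c ℤ.+ d)
        identity₁ = solve-∀
        identity₂ : ∀ (b d : ℤ) → ℤ.- (b ℤ.- d) ≡ ℤ.- b ℤ.- ℤ.- d
        identity₂ = solve-∀

conj-ι : ∀ c → conj (ι c) ≡ ι c
conj-ι c = Zφ-≡ (ℤP.+-identityʳ c) refl

-- conj φ = -φ⁻¹
conj-mulφ : ∀ x → conj (mulφ x) ≡ negφ (mulφ⁻¹ (conj x))
conj-mulφ x = Zφ-≡ (identity (re x) (im x)) refl
  where identity : ∀ (a b : ℤ) → b ℤ.+ (a ℤ.+ b) ≡ ℤ.- ((ℤ.- b) ℤ.- (a ℤ.+ b))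
        identity = solve-∀

scaleφ : ℕ → Zφ → Zφ
scaleφ zero x = x
scaleφ (suc k) x = mulφ (scaleφ k x)

scaleφ⁻¹ : ℕ → Zφ → Zφ
scaleφ⁻¹ zero x = x
scaleφ⁻¹ (suc k) x = mulφ⁻¹ (scaleφ⁻¹ k x)

φ^≡scaleφ : ∀ k → φ^ k ≡ scaleφ k 1φ
φ^≡scaleφ zero = refl
φ^≡scaleφ (suc k) = cong mulφ (φ^≡scaleφ k)

φ^-≡scaleφ⁻¹ : ∀ k → φ^- k ≡ scaleφ⁻¹ k 1φ
φ^-≡scaleφ⁻¹ zero = refl
φ^-≡scaleφ⁻¹ (suc k) = cong mulφ⁻¹ (φ^-≡scaleφ⁻¹ k)

scaleφ-0φ : ∀ k → scaleφ k 0φ ≡ 0φ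
scaleφ-0φ zero = refl
scaleφ-0φ (suc k) = cong mulφ (scaleφ-0φ k)

scaleφ⁻¹-0φ : ∀ k → scaleφ⁻¹ k 0φ ≡ 0φ
scaleφ⁻¹-0φ zero = refl
scaleφ⁻¹-0φ (suc k) = cong mulφ⁻¹ (scaleφ⁻¹-0φ k)

scaleφ-⊕ : ∀ k x y → scaleφ k (x ⊕ y) ≡ scaleφ k x ⊕ scaleφ k y
scaleφ-⊕ zero x y = refl
scaleφ-⊕ (suc k) x y = trans (cong mulφ (scaleφ-⊕ k x y)) (mulφ-⊕ (scaleφ k x) (scaleφ k y))

scaleφ-⊖ : ∀ k x y → scaleφ k (x ⊖ y) ≡ scaleφ k x ⊖ scaleφ k y
scaleφ-⊖ zero x y = refl
scaleφ-⊖ (suc k) x y = trans (cong mulφ (scaleφ-⊖ k x y)) (mulφ-⊖ (scaleφ k x) (scaleφ k y))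

scaleφ⁻¹-⊖ : ∀ k x y → scaleφ⁻¹ k (x ⊖ y) ≡ scaleφ⁻¹ k x ⊖ scaleφ⁻¹ k y
scaleφ⁻¹-⊖ zero x y = refl
scaleφ⁻¹-⊖ (suc k) x y = trans (cong mulφ⁻¹ (scaleφ⁻¹-⊖ k x y)) (mulφ⁻¹-⊖ (scaleφ⁻¹ k x) (scaleφ⁻¹ k y))

scaleφ-mulφ : ∀ k x → scaleφ k (mulφ x) ≡ mulφ (scaleφ k x)
scaleφ-mulφ zero x = refl
scaleφ-mulφ (suc k) x = cong mulφ (scaleφ-mulφ k x)

scaleφ-+ : ∀ a b x → scaleφ (a ℕ.+ b) x ≡ scaleφ b (scaleφ a x)
scaleφ-+ zero b x = refl
scaleφ-+ (suc a) b x = trans (cong mulφ (scaleφ-+ a b x)) (sym (scaleφ-mulφ b (scaleφ a x)))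

scaleφ-comm : ∀ a b x → scaleφ a (scaleφ b x) ≡ scaleφ b (scaleφ a x)
scaleφ-comm a b x =
  trans (sym (scaleφ-+ b a x)) (trans (cong (λ k → scaleφ k x) (ℕP.+-comm b a)) (scaleφ-+ a b x))

scaleφ⁻¹-mulφ : ∀ k x → scaleφ⁻¹ k (mulφ x) ≡ mulφ (scaleφ⁻¹ k x)
scaleφ⁻¹-mulφ zero x = refl
scaleφ⁻¹-mulφ (suc k) x =
  trans (cong mulφ⁻¹ (scaleφ⁻¹-mulφ k x)) (trans (mulφ⁻¹-mulφ _) (sym (mulφ-mulφ⁻¹ _)))

scaleφ-mulφ⁻¹ : ∀ k x → scaleφ k (mulφ⁻¹ x) ≡ mulφ⁻¹ (scaleφ k x)
scaleφ-mulφ⁻¹ zero x = refl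
scaleφ-mulφ⁻¹ (suc k) x =
  trans (cong mulφ (scaleφ-mulφ⁻¹ k x)) (trans (mulφ-mulφ⁻¹ _) (sym (mulφ⁻¹-mulφ _)))

scaleφ⁻¹-scaleφ : ∀ k x → scaleφ⁻¹ k (scaleφ k x) ≡ x
scaleφ⁻¹-scaleφ zero x = refl
scaleφ⁻¹-scaleφ (suc k) x =
  trans (cong mulφ⁻¹ (scaleφ⁻¹-mulφ k (scaleφ k x))) (trans (mulφ⁻¹-mulφ _) (scaleφ⁻¹-scaleφ k x))

scaleφ-scaleφ⁻¹ : ∀ k x → scaleφ k (scaleφ⁻¹ k x) ≡ x
scaleφ-scaleφ⁻¹ zero x = refl
scaleφ-scaleφ⁻¹ (suc k) x =
  trans (cong mulφ (scaleφ-mulφ⁻¹ k (scaleφ⁻¹ k x))) (trans (mulφ-mulφ⁻¹ _) (scaleφ-scaleφ⁻¹ k x))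

scaleφ-injective : ∀ k {x y} → scaleφ k x ≡ scaleφ k y → x ≡ y
scaleφ-injective k {x} {y} eq =
  trans (sym (scaleφ⁻¹-scaleφ k x)) (trans (cong (scaleφ⁻¹ k) eq) (scaleφ⁻¹-scaleφ k y))

scaleφ-φ^- : ∀ i k → scaleφ (i ℕ.+ k) (φ^- i) ≡ φ^ k
scaleφ-φ^- i k = begin
  scaleφ (i ℕ.+ k) (φ^- i)             ≡⟨ scaleφ-+ i k (φ^- i) ⟩
  scaleφ k (scaleφ i (φ^- i))          ≡⟨ cong (λ y → scaleφ k (scaleφ i y)) (φ^-≡scaleφ⁻¹ i) ⟩
  scaleφ k (scaleφ i (scaleφ⁻¹ i 1φ))  ≡⟨ cong (scaleφ k) (scaleφ-scaleφ⁻¹ i 1φ) ⟩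
  scaleφ k 1φ                          ≡⟨ sym (φ^≡scaleφ k) ⟩
  φ^ k                                 ∎
  where open ≡-Reasoning

scaleφ-φ : ∀ k → scaleφ k (φ^ 1) ≡ φ^ (suc k)
scaleφ-φ k = trans (sym (scaleφ-+ 1 k 1φ)) (sym (φ^≡scaleφ (suc k)))

-- conj φ² = φ⁻²
conj-scaleφ-even : ∀ t x → conj (scaleφ (double t) x) ≡ scaleφ⁻¹ (double t) (conj x)
conj-scaleφ-even zero x = refl
conj-scaleφ-even (suc t) x = begin
  conj (mulφ (mulφ y))                          ≡⟨ conj-mulφ (mulφ y) ⟩
  negφ (mulφ⁻¹ (conj (mulφ y)))                 ≡⟨ cong (λ z → negφ (mulφ⁻¹ z)) (conj-mulφ y) ⟩
  negφ (mulφ⁻¹ (negφ (mulφ⁻¹ (conj y))))        ≡⟨ cong negφ (mulφ⁻¹-negφ (mulφ⁻¹ (conj y))) ⟩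
  negφ (negφ (mulφ⁻¹ (mulφ⁻¹ (conj y))))        ≡⟨ negφ-involutive _ ⟩
  mulφ⁻¹ (mulφ⁻¹ (conj y))                      ≡⟨ cong (λ z → mulφ⁻¹ (mulφ⁻¹ z)) (conj-scaleφ-even t x) ⟩
  scaleφ⁻¹ (double (suc t)) (conj x)            ∎
  where open ≡-Reasoning
        y = scaleφ (double t) x

conj-scaleφ-odd : ∀ t x → conj (scaleφ (suc (double t)) x) ≡ negφ (scaleφ⁻¹ (suc (double t)) (conj x))
conj-scaleφ-odd t x =
  trans (conj-mulφ (scaleφ (double t) x)) (cong (λ z → negφ (mulφ⁻¹ z)) (conj-scaleφ-even t x))

φ^suc≡fib+fibφ : ∀ k → φ^ (suc k) ≡ fibℤ k +φ* fibℤ (suc k)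
φ^suc≡fib+fibφ zero = refl
φ^suc≡fib+fibφ (suc k) = trans (cong mulφ (φ^suc≡fib+fibφ k))
  (Zφ-≡ refl (trans (sym (ℤP.pos-+ (fib k) (fib (suc k)))) (cong +_ (ℕP.+-comm (fib k) (fib (suc k))))))

φ^-odd≡-fib+fibφ : ∀ t → φ^- (suc (double t)) ≡ (ℤ.- fibℤ (suc (suc (double t)))) +φ* fibℤ (suc (double t))
φ^-odd≡-fib+fibφ zero = refl
φ^-odd≡-fib+fibφ (suc t) = trans (cong (λ z → mulφ⁻¹ (mulφ⁻¹ z)) (φ^-odd≡-fib+fibφ t))
  (Zφ-≡ (trans (identity₁ a b) (cong ℤ.-_ (sym (trans (fibℤ-rec (suc (suc (double t)))) (cong (ℤ._+ a) F₃)))))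
        (trans (identity₂ a b) (sym F₃)))
  where
  a = fibℤ (suc (suc (double t)))
  b = fibℤ (suc (double t))
  F₃ : fibℤ (suc (suc (suc (double t)))) ≡ a ℤ.+ b
  F₃ = fibℤ-rec (suc (double t))
  identity₁ : ∀ (a b : ℤ) → (ℤ.- a) ℤ.- (b ℤ.- ℤ.- a) ≡ ℤ.- ((a ℤ.+ b) ℤ.+ a)
  identity₁ = solve-∀
  identity₂ : ∀ (a b : ℤ) → b ℤ.- ℤ.- a ≡ a ℤ.+ b
  identity₂ = solve-∀

-- For odd k, φᵏ - φ⁻ᵏ = Lₖ and φᵏ + φ⁻ᵏ = Fₖ√5; the element √5·b is encoded as -b + 2bφ.
√5* : ℤ → Zφ
√5* b = (ℤ.- b) +φ* (b ℤ.+ b)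

√5*-⊕ : ∀ a b → √5* (a ℤ.+ b) ≡ √5* a ⊕ √5* b
√5*-⊕ a b = Zφ-≡ (ℤP.neg-distrib-+ a b) (identity a b)
  where identity : ∀ (a b : ℤ) → (a ℤ.+ b) ℤ.+ (a ℤ.+ b) ≡ (a ℤ.+ a) ℤ.+ (b ℤ.+ b)
        identity = solve-∀

√5*fib-odd : ∀ t → √5* (fibℤ (suc (double t))) ≡ φ^ (suc (double t)) ⊕ φ^- (suc (double t))
√5*fib-odd t = trans (Zφ-≡ re-eq refl) (sym (cong₂ _⊕_ (φ^suc≡fib+fibφ (double t)) (φ^-odd≡-fib+fibφ t)))
  where
  identity : ∀ (a b : ℤ) → a ℤ.+ ℤ.- (b ℤ.+ a) ≡ ℤ.- b
  identity = solve-∀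
  re-eq : ℤ.- fibℤ (suc (double t)) ≡ fibℤ (double t) ℤ.+ ℤ.- fibℤ (suc (suc (double t)))
  re-eq = trans (sym (identity (fibℤ (double t)) (fibℤ (suc (double t)))))
                (cong (λ z → fibℤ (double t) ℤ.+ ℤ.- z) (sym (fibℤ-rec (double t))))

φ^odd≡lucas+φ^- : ∀ t → φ^ (suc (double t)) ≡ ι (+ lucas (suc (double t))) ⊕ φ^- (suc (double t))
φ^odd≡lucas+φ^- t = trans (sym (⊖-⊕-cancel _ _)) (cong (_⊕ φ^- (suc (double t))) (sym lucas-eq))
  where
  identity : ∀ (a b : ℤ) → a ℤ.- ℤ.- b ≡ a ℤ.+ b
  identity = solve-∀
  re-eq : + lucas (suc (double t)) ≡ fibℤ (double t) ℤ.- ℤ.- fibℤ (suc (suc (double t)))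
  re-eq = trans (cong +_ (lucas≡fib+fib (double t)))
                (trans (ℤP.pos-+ (fib (double t)) _) (sym (identity (fibℤ (double t)) (fibℤ (suc (suc (double t)))))))
  lucas-eq : ι (+ lucas (suc (double t))) ≡ φ^ (suc (double t)) ⊖ φ^- (suc (double t))
  lucas-eq = trans (Zφ-≡ re-eq (sym (ℤP.+-inverseʳ (fibℤ (suc (double t))))))
                   (sym (cong₂ _⊖_ (φ^suc≡fib+fibφ (double t)) (φ^-odd≡-fib+fibφ t)))

-- The order of ℤ[φ] ⊂ ℝ

-- coeff j x is the φ-coefficient of x·φʲ. By Binet it equals (x φʲ - (conj x) (1-φ)ʲ)/√5,
-- so for large j it has the sign of x: comparing reals becomes comparing integers eventually.
coeff : ℕ → Zφ → ℤ
coeff j x = re x ℤ.* fibℤ j ℤ.+ im x ℤ.* fibℤ (suc j)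

coeff-⊕ : ∀ j x y → coeff j (x ⊕ y) ≡ coeff j x ℤ.+ coeff j y
coeff-⊕ j x y = identity (re x) (im x) (re y) (im y) (fibℤ j) (fibℤ (suc j))
  where identity : ∀ (a b c d f g : ℤ) →
                   (a ℤ.+ c) ℤ.* f ℤ.+ (b ℤ.+ d) ℤ.* g ≡ (a ℤ.* f ℤ.+ b ℤ.* g) ℤ.+ (c ℤ.* f ℤ.+ d ℤ.* g)
        identity = solve-∀

coeff-⊖ : ∀ j x y → coeff j (x ⊖ y) ≡ coeff j x ℤ.- coeff j y
coeff-⊖ j x y = identity (re x) (im x) (re y) (im y) (fibℤ j) (fibℤ (suc j))
  where identity : ∀ (a b c d f g : ℤ) →
                   (a ℤ.- c) ℤ.* f ℤ.+ (b ℤ.- d) ℤ.* g ≡ (a ℤ.* f ℤ.+ b ℤ.* g) ℤ.- (c ℤ.* f ℤ.+ d ℤ.* g)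
        identity = solve-∀

coeff-negφ : ∀ j x → coeff j (negφ x) ≡ ℤ.- coeff j x
coeff-negφ j x = identity (re x) (im x) (fibℤ j) (fibℤ (suc j))
  where identity : ∀ (a b f g : ℤ) → (ℤ.- a) ℤ.* f ℤ.+ (ℤ.- b) ℤ.* g ≡ ℤ.- (a ℤ.* f ℤ.+ b ℤ.* g)
        identity = solve-∀

coeff-mulφ : ∀ j x → coeff j (mulφ x) ≡ coeff (suc j) x
coeff-mulφ j x = trans (identity (re x) (im x) (fibℤ j) (fibℤ (suc j)))
                       (cong (λ z → re x ℤ.* fibℤ (suc j) ℤ.+ im x ℤ.* z) (sym (fibℤ-rec j)))
  where identity : ∀ (a b f g : ℤ) → b ℤ.* f ℤ.+ (a ℤ.+ b) ℤ.* g ≡ a ℤ.* g ℤ.+ b ℤ.* (g ℤ.+ f)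
        identity = solve-∀

coeff-mulφ⁻¹ : ∀ j x → coeff (suc j) (mulφ⁻¹ x) ≡ coeff j x
coeff-mulφ⁻¹ j x = trans (cong (λ w → (im x ℤ.- re x) ℤ.* fibℤ (suc j) ℤ.+ re x ℤ.* w) (fibℤ-rec j))
                         (identity (re x) (im x) (fibℤ j) (fibℤ (suc j)))
  where identity : ∀ (a b f g : ℤ) → (b ℤ.- a) ℤ.* g ℤ.+ a ℤ.* (g ℤ.+ f) ≡ a ℤ.* f ℤ.+ b ℤ.* g
        identity = solve-∀

coeff-ι : ∀ j c → coeff j (ι c) ≡ c ℤ.* fibℤ j
coeff-ι j c = ℤP.+-identityʳ (c ℤ.* fibℤ j)

coeff-0φ : ∀ j → coeff j 0φ ≡ + 0
coeff-0φ j = coeff-ι j (+ 0)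

coeff-1φ : ∀ j → coeff j 1φ ≡ fibℤ j
coeff-1φ j = trans (coeff-ι j (+ 1)) (ℤP.*-identityˡ (fibℤ j))

coeff-scaleφ : ∀ k j x → coeff j (scaleφ k x) ≡ coeff (k ℕ.+ j) x
coeff-scaleφ zero j x = refl
coeff-scaleφ (suc k) j x = trans (coeff-mulφ j (scaleφ k x))
  (trans (coeff-scaleφ k (suc j) x) (cong (λ i → coeff i x) (ℕP.+-suc k j)))

coeff-scaleφ⁻¹ : ∀ k j x → coeff (k ℕ.+ j) (scaleφ⁻¹ k x) ≡ coeff j x
coeff-scaleφ⁻¹ zero j x = refl
coeff-scaleφ⁻¹ (suc k) j x = trans (coeff-mulφ⁻¹ (k ℕ.+ j) (scaleφ⁻¹ k x)) (coeff-scaleφ⁻¹ k j x)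

coeff-φ^ : ∀ k j → coeff j (φ^ k) ≡ fibℤ (k ℕ.+ j)
coeff-φ^ k j = trans (cong (coeff j) (φ^≡scaleφ k)) (trans (coeff-scaleφ k j 1φ) (coeff-1φ (k ℕ.+ j)))

coeff-φ^- : ∀ k j → coeff (k ℕ.+ j) (φ^- k) ≡ fibℤ j
coeff-φ^- k j = trans (cong (coeff (k ℕ.+ j)) (φ^-≡scaleφ⁻¹ k)) (trans (coeff-scaleφ⁻¹ k j 1φ) (coeff-1φ j))

Eventually : (ℕ → Set) → Set
Eventually P = ∃ λ k → ∀ j → k ≤ j → P j

Eventually-map : ∀ {P Q : ℕ → Set} → (∀ {j} → P j → Q j) → Eventually P → Eventually Q
Eventually-map f (k , p) = k , λ j k≤j → f (p j k≤j)

Eventually-zip : ∀ {P Q R : ℕ → Set} → (∀ {j} → P j → Q j → R j) → Eventually P → Eventually Q → Eventually R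
Eventually-zip f (k , p) (l , q) =
  k ℕ.⊔ l , λ j h → f (p j (ℕP.≤-trans (ℕP.m≤m⊔n k l) h)) (q j (ℕP.≤-trans (ℕP.m≤n⊔m k l) h))

Eventually-witness : ∀ {P : ℕ → Set} → Eventually P → ∃ P
Eventually-witness (k , p) = k , p k ℕP.≤-refl

Eventually-≤ : ∀ k → Eventually (k ≤_)
Eventually-≤ k = k , λ _ k≤j → k≤j

infix 4 _≺_ _≼_

-- records rather than definitions, so that unification never unfolds the order

record _≺_ (x y : Zφ) : Set where
  constructor mk≺
  field eventually< : Eventually (λ j → coeff j x ℤ.< coeff j y)

record _≼_ (x y : Zφ) : Set where
  constructor mk≼
  field eventually≤ : Eventually (λ j → coeff j x ℤ.≤ coeff j y)

≺-trans : ∀ {x y z} → x ≺ y → y ≺ z → x ≺ z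
≺-trans (mk≺ p) (mk≺ q) = mk≺ (Eventually-zip ℤP.<-trans p q)

≼-trans : ∀ {x y z} → x ≼ y → y ≼ z → x ≼ z
≼-trans (mk≼ p) (mk≼ q) = mk≼ (Eventually-zip ℤP.≤-trans p q)

≺-≼-trans : ∀ {x y z} → x ≺ y → y ≼ z → x ≺ z
≺-≼-trans (mk≺ p) (mk≼ q) = mk≺ (Eventually-zip ℤP.<-≤-trans p q)

≼-≺-trans : ∀ {x y z} → x ≼ y → y ≺ z → x ≺ z
≼-≺-trans (mk≼ p) (mk≺ q) = mk≺ (Eventually-zip ℤP.≤-<-trans p q)

≺⇒≼ : ∀ {x y} → x ≺ y → x ≼ y
≺⇒≼ (mk≺ p) = mk≼ (Eventually-map ℤP.<⇒≤ p)

≼-refl : ∀ {x} → x ≼ x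
≼-refl = mk≼ (0 , λ _ _ → ℤP.≤-refl)

≺⇒⋡ : ∀ {x y} → x ≺ y → ¬ (y ≼ x)
≺⇒⋡ (mk≺ p) (mk≼ q) with Eventually-witness (Eventually-zip _,_ p q)
... | _ , (lt , ge) = ℤP.<⇒≱ lt ge

≺-irrefl : ∀ {x} → ¬ (x ≺ x)
≺-irrefl x≺x = ≺⇒⋡ x≺x ≼-refl

≺-respʳ : ∀ {x y y'} → y ≡ y' → x ≺ y → x ≺ y'
≺-respʳ refl h = h

≺-respˡ : ∀ {x x' y} → x ≡ x' → x ≺ y → x' ≺ y
≺-respˡ refl h = h

≼-respʳ : ∀ {x y y'} → y ≡ y' → x ≼ y → x ≼ y'
≼-respʳ refl h = h

≼-respˡ : ∀ {x x' y} → x ≡ x' → x ≼ y → x' ≼ y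
≼-respˡ refl h = h

⊕-mono-≺-≼ : ∀ {x y x' y'} → x ≺ y → x' ≼ y' → x ⊕ x' ≺ y ⊕ y'
⊕-mono-≺-≼ {x} {y} {x'} {y'} (mk≺ p) (mk≼ q) = mk≺ (Eventually-zip (λ {j} a b →
  subst₂ ℤ._<_ (sym (coeff-⊕ j x x')) (sym (coeff-⊕ j y y')) (ℤP.+-mono-<-≤ a b)) p q)

⊕-mono-≼-≺ : ∀ {x y x' y'} → x ≼ y → x' ≺ y' → x ⊕ x' ≺ y ⊕ y'
⊕-mono-≼-≺ {x} {y} {x'} {y'} (mk≼ p) (mk≺ q) = mk≺ (Eventually-zip (λ {j} a b →
  subst₂ ℤ._<_ (sym (coeff-⊕ j x x')) (sym (coeff-⊕ j y y')) (ℤP.+-mono-≤-< a b)) p q)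

⊕-mono-≼ : ∀ {x y x' y'} → x ≼ y → x' ≼ y' → x ⊕ x' ≼ y ⊕ y'
⊕-mono-≼ {x} {y} {x'} {y'} (mk≼ p) (mk≼ q) = mk≼ (Eventually-zip (λ {j} a b →
  subst₂ ℤ._≤_ (sym (coeff-⊕ j x x')) (sym (coeff-⊕ j y y')) (ℤP.+-mono-≤ a b)) p q)

⊕-monoʳ-≺ : ∀ z {x y} → x ≺ y → z ⊕ x ≺ z ⊕ y
⊕-monoʳ-≺ z = ⊕-mono-≼-≺ (≼-refl {z})

⊖-mono-≺-≼ : ∀ {x a y b} → x ≺ a → b ≼ y → x ⊖ y ≺ a ⊖ b
⊖-mono-≺-≼ {x} {a} {y} {b} (mk≺ p) (mk≼ q) = mk≺ (Eventually-zip (λ {j} u w →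
  subst₂ ℤ._<_ (sym (coeff-⊖ j x y)) (sym (coeff-⊖ j a b)) (ℤP.+-mono-<-≤ u (ℤP.neg-mono-≤ w))) p q)

⊖-mono-≼-≺ : ∀ {x a y b} → x ≼ a → b ≺ y → x ⊖ y ≺ a ⊖ b
⊖-mono-≼-≺ {x} {a} {y} {b} (mk≼ p) (mk≺ q) = mk≺ (Eventually-zip (λ {j} u w →
  subst₂ ℤ._<_ (sym (coeff-⊖ j x y)) (sym (coeff-⊖ j a b)) (ℤP.+-mono-≤-< u (ℤP.neg-mono-< w))) p q)

⊖-mono-≺ : ∀ {x a y b} → x ≺ a → b ≺ y → x ⊖ y ≺ a ⊖ b
⊖-mono-≺ p q = ⊖-mono-≺-≼ p (≺⇒≼ q)

negφ-antimono-≺ : ∀ {x y} → x ≺ y → negφ y ≺ negφ x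
negφ-antimono-≺ {x} {y} (mk≺ p) = mk≺ (Eventually-map (λ {j} a →
  subst₂ ℤ._<_ (sym (coeff-negφ j y)) (sym (coeff-negφ j x)) (ℤP.neg-mono-< a)) p)

mulφ-mono-≺ : ∀ {x y} → x ≺ y → mulφ x ≺ mulφ y
mulφ-mono-≺ {x} {y} (mk≺ (k , p)) = mk≺ (k , λ j k≤j →
  subst₂ ℤ._<_ (sym (coeff-mulφ j x)) (sym (coeff-mulφ j y)) (p (suc j) (ℕP.m≤n⇒m≤1+n k≤j)))

mulφ-mono-≼ : ∀ {x y} → x ≼ y → mulφ x ≼ mulφ y
mulφ-mono-≼ {x} {y} (mk≼ (k , p)) = mk≼ (k , λ j k≤j →
  subst₂ ℤ._≤_ (sym (coeff-mulφ j x)) (sym (coeff-mulφ j y)) (p (suc j) (ℕP.m≤n⇒m≤1+n k≤j)))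

mulφ⁻¹-mono-≺ : ∀ {x y} → x ≺ y → mulφ⁻¹ x ≺ mulφ⁻¹ y
mulφ⁻¹-mono-≺ {x} {y} (mk≺ (k , p)) = mk≺ (suc k , λ { (suc j) (s≤s k≤j) →
  subst₂ ℤ._<_ (sym (coeff-mulφ⁻¹ j x)) (sym (coeff-mulφ⁻¹ j y)) (p j k≤j) })

mulφ⁻¹-mono-≼ : ∀ {x y} → x ≼ y → mulφ⁻¹ x ≼ mulφ⁻¹ y
mulφ⁻¹-mono-≼ {x} {y} (mk≼ (k , p)) = mk≼ (suc k , λ { (suc j) (s≤s k≤j) →
  subst₂ ℤ._≤_ (sym (coeff-mulφ⁻¹ j x)) (sym (coeff-mulφ⁻¹ j y)) (p j k≤j) })

scaleφ-mono-≺ : ∀ k {x y} → x ≺ y → scaleφ k x ≺ scaleφ k y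
scaleφ-mono-≺ zero h = h
scaleφ-mono-≺ (suc k) h = mulφ-mono-≺ (scaleφ-mono-≺ k h)

scaleφ⁻¹-mono-≺ : ∀ k {x y} → x ≺ y → scaleφ⁻¹ k x ≺ scaleφ⁻¹ k y
scaleφ⁻¹-mono-≺ zero h = h
scaleφ⁻¹-mono-≺ (suc k) h = mulφ⁻¹-mono-≺ (scaleφ⁻¹-mono-≺ k h)

scaleφ⁻¹-mono-≼ : ∀ k {x y} → x ≼ y → scaleφ⁻¹ k x ≼ scaleφ⁻¹ k y
scaleφ⁻¹-mono-≼ zero h = h
scaleφ⁻¹-mono-≼ (suc k) h = mulφ⁻¹-mono-≼ (scaleφ⁻¹-mono-≼ k h)

-- conj (x·φ) = -(conj x)/φ
flip-antimono-≺ : ∀ {x y} → x ≺ y → negφ (mulφ⁻¹ y) ≺ negφ (mulφ⁻¹ x)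
flip-antimono-≺ h = negφ-antimono-≺ (mulφ⁻¹-mono-≺ h)

ι-mono-≼ : ∀ {a b} → a ℤ.≤ b → ι a ≼ ι b
ι-mono-≼ {a} {b} a≤b = mk≼ (0 , λ j _ →
  subst₂ ℤ._≤_ (sym (coeff-ι j a)) (sym (coeff-ι j b)) (*-monoʳ-≤ (+≤+ z≤n) a≤b))

ι-cancel-≺ : ∀ {a b} → ι a ≺ ι b → a ℤ.< b
ι-cancel-≺ {a} {b} h with a ℤ.<? b
... | yes a<b = a<b
... | no a≮b = ⊥-elim (≺⇒⋡ h (ι-mono-≼ (ℤP.≮⇒≥ a≮b)))

≺-by-difference : ∀ {x y a b} → y ⊖ x ≡ b ⊖ a → a ≺ b → x ≺ y
≺-by-difference {x} {y} {a} {b} eq (mk≺ p) = mk≺ (Eventually-map (λ {j} a<b →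
  let 0<d = subst (+ 0 ℤ.<_) (trans (sym (coeff-⊖ j b a)) (trans (cong (coeff j) (sym eq)) (coeff-⊖ j y x)))
                  (i<j⇒0<j-i a<b)
  in <-by-pos _ 0<d (sym (identity (coeff j x) (coeff j y)))) p)
  where identity : ∀ (u w : ℤ) → u ℤ.+ (w ℤ.- u) ≡ w
        identity = solve-∀

≼-by-difference : ∀ {x y a b} → y ⊖ x ≡ b ⊖ a → a ≼ b → x ≼ y
≼-by-difference {x} {y} {a} {b} eq (mk≼ p) = mk≼ (Eventually-map (λ {j} a≤b →
  let 0≤d = subst (+ 0 ℤ.≤_) (trans (sym (coeff-⊖ j b a)) (trans (cong (coeff j) (sym eq)) (coeff-⊖ j y x)))
                  (ℤP.i≤j⇒0≤j-i a≤b)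
  in ≤-by-nonneg _ 0≤d (sym (identity (coeff j x) (coeff j y)))) p)
  where identity : ∀ (u w : ℤ) → u ℤ.+ (w ℤ.- u) ≡ w
        identity = solve-∀

0≺φ^ : ∀ k → 0φ ≺ φ^ k
0≺φ^ k = mk≺ (1 , λ { (suc j) _ → subst₂ ℤ._<_ (sym (coeff-0φ (suc j))) (sym (coeff-φ^ k (suc j)))
  (subst (λ i → + 0 ℤ.< fibℤ i) (sym (ℕP.+-suc k j)) (fibℤ-pos (k ℕ.+ j))) })

0≺φ^- : ∀ k → 0φ ≺ φ^- k
0≺φ^- k = mk≺ (suc k , go)
  where
  go : ∀ j → suc k ≤ j → coeff j 0φ ℤ.< coeff j (φ^- k)
  go j k<j with ℕP.m≤n⇒∃[o]m+o≡n k<j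
  ... | o , refl = subst₂ ℤ._<_ (sym (coeff-0φ (suc k ℕ.+ o)))
    (sym (trans (cong (λ i → coeff i (φ^- k)) (sym (ℕP.+-suc k o))) (coeff-φ^- k (suc o))))
    (fibℤ-pos o)

φ^≼φ^ : ∀ {a b} → a ≤ b → φ^ a ≼ φ^ b
φ^≼φ^ {a} {b} a≤b = mk≼ (0 , λ j _ → subst₂ ℤ._≤_ (sym (coeff-φ^ a j)) (sym (coeff-φ^ b j))
  (+≤+ (fib-mono (ℕP.+-monoˡ-≤ j a≤b))))

φ^-suc≺1 : ∀ k → φ^- (suc k) ≺ 1φ
φ^-suc≺1 k = mk≺ (suc k ℕ.+ 3 , go)
  where
  go : ∀ j → suc k ℕ.+ 3 ≤ j → coeff j (φ^- (suc k)) ℤ.< coeff j 1φ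
  go j h with ℕP.m≤n⇒∃[o]m+o≡n h
  ... | o , refl = subst₂ ℤ._<_
    (sym (trans (cong (λ i → coeff i (φ^- (suc k))) (ℕP.+-assoc (suc k) 3 o)) (coeff-φ^- (suc k) (3 ℕ.+ o))))
    (sym (coeff-1φ (suc k ℕ.+ 3 ℕ.+ o)))
    (+<+ (ℕP.<-≤-trans (fib-<-suc (suc o)) (fib-mono (ℕP.+-monoˡ-≤ o (s≤s (ℕP.m≤n+m 3 k))))))

φ^-suc≼φ^-1 : ∀ k → φ^- (suc k) ≼ φ^- 1
φ^-suc≼φ^-1 k = mk≼ (suc k , go)
  where
  go : ∀ j → suc k ≤ j → coeff j (φ^- (suc k)) ℤ.≤ coeff j (φ^- 1)
  go j h with ℕP.m≤n⇒∃[o]m+o≡n h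
  ... | o , refl = subst₂ ℤ._≤_ (sym (coeff-φ^- (suc k) o)) (sym (coeff-φ^- 1 (k ℕ.+ o)))
    (+≤+ (fib-mono (ℕP.m≤n+m o k)))

-- From Posφ to the eventual order

minus1^ : ℕ → ℤ
minus1^ zero = + 1
minus1^ (suc j) = ℤ.- minus1^ j

minus1^-odd : ∀ t → minus1^ (suc (double t)) ≡ ℤ.- (+ 1)
minus1^-odd zero = refl
minus1^-odd (suc t) = cong (λ w → ℤ.- (ℤ.- w)) (minus1^-odd t)

minus1^-even : ∀ t → minus1^ (double t) ≡ + 1
minus1^-even zero = refl
minus1^-even (suc t) = cong (λ w → ℤ.- (ℤ.- w)) (minus1^-even t)

cassini : ∀ j → fibℤ (suc j) ℤ.* fibℤ (suc j) ℤ.- fibℤ (suc j) ℤ.* fibℤ j ℤ.- fibℤ j ℤ.* fibℤ j ≡ minus1^ j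
cassini zero = refl
cassini (suc j) =
  trans (cong (λ w → w ℤ.* w ℤ.- w ℤ.* fibℤ (suc j) ℤ.- fibℤ (suc j) ℤ.* fibℤ (suc j)) (fibℤ-rec j))
        (trans (identity (fibℤ (suc j)) (fibℤ j)) (cong ℤ.-_ (cassini j)))
  where identity : ∀ (a b : ℤ) → (a ℤ.+ b) ℤ.* (a ℤ.+ b) ℤ.- (a ℤ.+ b) ℤ.* a ℤ.- a ℤ.* a ≡ ℤ.- (a ℤ.* a ℤ.- a ℤ.* b ℤ.- b ℤ.* b)
        identity = solve-∀

lucasℤ : ℕ → ℤ
lucasℤ j = fibℤ (suc j) ℤ.+ fibℤ (suc j) ℤ.- fibℤ j

lucasℤ-squared : ∀ j → lucasℤ j ℤ.* lucasℤ j ≡ + 5 ℤ.* (fibℤ j ℤ.* fibℤ j) ℤ.+ + 4 ℤ.* minus1^ j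
lucasℤ-squared j = trans (identity (fibℤ (suc j)) (fibℤ j)) (cong (λ w → + 5 ℤ.* (fibℤ j ℤ.* fibℤ j) ℤ.+ + 4 ℤ.* w) (cassini j))
  where identity : ∀ (a b : ℤ) → (a ℤ.+ a ℤ.- b) ℤ.* (a ℤ.+ a ℤ.- b)
                   ≡ + 5 ℤ.* (b ℤ.* b) ℤ.+ + 4 ℤ.* (a ℤ.* a ℤ.- a ℤ.* b ℤ.- b ℤ.* b)
        identity = solve-∀

lucasℤ-pos : ∀ j → + 0 ℤ.< lucasℤ j
lucasℤ-pos j = ℤP.<-≤-trans (fibℤ-pos j) (≤-by-nonneg (fibℤ (suc j) ℤ.- fibℤ j) (ℤP.i≤j⇒0≤j-i (+≤+ (fib-≤-suc j))) (identity (fibℤ j) (fibℤ (suc j))))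
  where identity : ∀ (f g : ℤ) → g ℤ.+ g ℤ.- f ≡ g ℤ.+ (g ℤ.- f)
        identity = solve-∀

-- s Fⱼ + b Lⱼ = (s + b√5) φʲ + o(1), so it is eventually positive iff s + b√5 > 0.
fibLucas : ℤ → ℤ → ℕ → ℤ
fibLucas s b j = s ℤ.* fibℤ j ℤ.+ b ℤ.* lucasℤ j

fibLucas-rec : ∀ s b j → fibLucas s b (suc (suc j)) ≡ fibLucas s b (suc j) ℤ.+ fibLucas s b j
fibLucas-rec s b j =
  trans (cong₂ (λ u w → s ℤ.* u ℤ.+ b ℤ.* (w ℤ.+ w ℤ.- u)) (fibℤ-rec j)
               (trans (fibℤ-rec (suc j)) (cong (ℤ._+ fibℤ (suc j)) (fibℤ-rec j))))
        (identity s b (fibℤ j) (fibℤ (suc j)))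
  where identity : ∀ (s b f g : ℤ) → s ℤ.* (g ℤ.+ f) ℤ.+ b ℤ.* (((g ℤ.+ f) ℤ.+ g) ℤ.+ ((g ℤ.+ f) ℤ.+ g) ℤ.- (g ℤ.+ f))
                   ≡ (s ℤ.* g ℤ.+ b ℤ.* ((g ℤ.+ f) ℤ.+ (g ℤ.+ f) ℤ.- g)) ℤ.+ (s ℤ.* f ℤ.+ b ℤ.* (g ℤ.+ g ℤ.- f))
        identity = solve-∀

fibLucas≡2coeff : ∀ a b j → fibLucas (+ 2 ℤ.* a ℤ.+ b) b j ≡ coeff j (a +φ* b) ℤ.+ coeff j (a +φ* b)
fibLucas≡2coeff a b j = identity a b (fibℤ j) (fibℤ (suc j))
  where identity : ∀ (a b f g : ℤ) → (+ 2 ℤ.* a ℤ.+ b) ℤ.* f ℤ.+ b ℤ.* (g ℤ.+ g ℤ.- f) ≡ (a ℤ.* f ℤ.+ b ℤ.* g) ℤ.+ (a ℤ.* f ℤ.+ b ℤ.* g)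
        identity = solve-∀

fibLucas-persists : ∀ s b k → + 0 ℤ.< fibLucas s b k → + 0 ℤ.< fibLucas s b (suc k) → Eventually (λ j → + 0 ℤ.< fibLucas s b j)
fibLucas-persists s b k pos₀ pos₁ = k , λ j k≤j → from k≤j
  where
  both : ∀ o → (+ 0 ℤ.< fibLucas s b (o ℕ.+ k)) × (+ 0 ℤ.< fibLucas s b (suc o ℕ.+ k))
  both zero = pos₀ , pos₁
  both (suc o) = let p , q = both o in
    q , subst (+ 0 ℤ.<_) (sym (fibLucas-rec s b (o ℕ.+ k))) (ℤP.+-mono-<-≤ q (ℤP.<⇒≤ p))
  from : ∀ {j} → k ≤ j → + 0 ℤ.< fibLucas s b j
  from {j} k≤j = subst (λ i → + 0 ℤ.< fibLucas s b i) (trans (ℕP.+-comm _ k) (ℕP.m+[n∸m]≡n k≤j)) (proj₁ (both (j ∸ k)))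

square-difference-pos : ∀ {X W : ℤ} → + 0 ℤ.≤ X → + 0 ℤ.≤ W → + 0 ℤ.< X ℤ.* X ℤ.- W ℤ.* W → + 0 ℤ.< X ℤ.- W
square-difference-pos {X} {W} 0≤X 0≤W pos with W ℤ.<? X
... | yes W<X = i<j⇒0<j-i W<X
... | no W≮X = ⊥-elim (ℤP.<⇒≱ pos (subst (X ℤ.* X ℤ.- W ℤ.* W ℤ.≤_) (ℤP.+-inverseʳ (W ℤ.* W))
                                        (ℤP.+-monoˡ-≤ (ℤ.- (W ℤ.* W)) X²≤W²)))
  where
  X≤W = ℤP.≮⇒≥ W≮X
  X²≤W² : X ℤ.* X ℤ.≤ W ℤ.* W
  X²≤W² = ℤP.≤-trans (*-monoʳ-≤ 0≤X X≤W) (subst₂ ℤ._≤_ (ℤP.*-comm X W) refl (*-monoʳ-≤ 0≤W X≤W))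

-- Terms of opposite signs are compared through their squares, using Lⱼ² = 5Fⱼ² + 4(-1)ʲ.
fibLucas-pos-of-squares : ∀ s b j → s ℤ.≤ + 0 → + 0 ℤ.≤ b →
  + 0 ℤ.< (b ℤ.* b) ℤ.* (+ 5 ℤ.* (fibℤ j ℤ.* fibℤ j) ℤ.+ + 4 ℤ.* minus1^ j) ℤ.- (s ℤ.* s) ℤ.* (fibℤ j ℤ.* fibℤ j) →
  + 0 ℤ.< fibLucas s b j
fibLucas-pos-of-squares s b j s≤0 0≤b pos =
  subst (+ 0 ℤ.<_) (identity₁ s b F (lucasℤ j))
    (square-difference-pos (0≤-* 0≤b (ℤP.<⇒≤ (lucasℤ-pos j))) (0≤-* (ℤP.neg-mono-≤ s≤0) (+≤+ z≤n))
      (subst (+ 0 ℤ.<_) (sym (trans (identity₂ b (lucasℤ j) s F)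
        (cong (λ w → (b ℤ.* b) ℤ.* w ℤ.- (s ℤ.* s) ℤ.* (F ℤ.* F)) (lucasℤ-squared j)))) pos))
  where
  F = fibℤ j
  identity₁ : ∀ (s b F L : ℤ) → b ℤ.* L ℤ.- (ℤ.- s) ℤ.* F ≡ s ℤ.* F ℤ.+ b ℤ.* L
  identity₁ = solve-∀
  identity₂ : ∀ (b L s F : ℤ) → (b ℤ.* L) ℤ.* (b ℤ.* L) ℤ.- ((ℤ.- s) ℤ.* F) ℤ.* ((ℤ.- s) ℤ.* F)
              ≡ (b ℤ.* b) ℤ.* (L ℤ.* L) ℤ.- (s ℤ.* s) ℤ.* (F ℤ.* F)
  identity₂ = solve-∀

fibLucas-pos-of-squares′ : ∀ s b j → + 0 ℤ.≤ s → b ℤ.≤ + 0 →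
  + 0 ℤ.< (s ℤ.* s) ℤ.* (fibℤ j ℤ.* fibℤ j) ℤ.- (b ℤ.* b) ℤ.* (+ 5 ℤ.* (fibℤ j ℤ.* fibℤ j) ℤ.+ + 4 ℤ.* minus1^ j) →
  + 0 ℤ.< fibLucas s b j
fibLucas-pos-of-squares′ s b j 0≤s b≤0 pos =
  subst (+ 0 ℤ.<_) (identity₁ s b F (lucasℤ j))
    (square-difference-pos (0≤-* 0≤s (+≤+ z≤n)) (0≤-* (ℤP.neg-mono-≤ b≤0) (ℤP.<⇒≤ (lucasℤ-pos j)))
      (subst (+ 0 ℤ.<_) (sym (trans (identity₂ b (lucasℤ j) s F)
        (cong (λ w → (s ℤ.* s) ℤ.* (F ℤ.* F) ℤ.- (b ℤ.* b) ℤ.* w) (lucasℤ-squared j)))) pos))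
  where
  F = fibℤ j
  identity₁ : ∀ (s b F L : ℤ) → s ℤ.* F ℤ.- (ℤ.- b) ℤ.* L ≡ s ℤ.* F ℤ.+ b ℤ.* L
  identity₁ = solve-∀
  identity₂ : ∀ (b L s F : ℤ) → (s ℤ.* F) ℤ.* (s ℤ.* F) ℤ.- ((ℤ.- b) ℤ.* L) ℤ.* ((ℤ.- b) ℤ.* L)
              ≡ (s ℤ.* s) ℤ.* (F ℤ.* F) ℤ.- (b ℤ.* b) ℤ.* (L ℤ.* L)
  identity₂ = solve-∀

fibLucas-pos-nonneg : ∀ s b → + 0 ℤ.≤ s → + 0 ℤ.≤ b → (+ 0 ℤ.< s ⊎ + 0 ℤ.< b) → Eventually (λ j → + 0 ℤ.< fibLucas s b j)
fibLucas-pos-nonneg s b 0≤s 0≤b (inj₁ 0<s) = 1 , λ { (suc j) _ →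
  ℤP.+-mono-<-≤ (0<-* 0<s (fibℤ-pos j)) (0≤-* 0≤b (ℤP.<⇒≤ (lucasℤ-pos (suc j)))) }
fibLucas-pos-nonneg s b 0≤s 0≤b (inj₂ 0<b) = 0 , λ j _ →
  subst (+ 0 ℤ.<_) (ℤP.+-comm (b ℤ.* lucasℤ j) (s ℤ.* fibℤ j)) (ℤP.+-mono-<-≤ (0<-* 0<b (lucasℤ-pos j)) (0≤-* 0≤s (+≤+ z≤n)))

2t<fib : ∀ t → + t ℤ.+ + t ℤ.< fibℤ (suc (double (suc t)))
2t<fib t = ℤP.suc[i]≤j⇒i<j (subst (ℤ._≤ fibℤ (suc (double (suc t)))) (trans (cong (λ w → + suc w) 2t≡t+t) (cong (λ w → + 1 ℤ.+ w) (ℤP.pos-+ t t)))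
             (+≤+ (n≤fib[2+n] (suc (double t)))))
  where 2t≡t+t : double t ≡ t ℕ.+ t
        2t≡t+t = trans (double≡2* t) (cong (t ℕ.+_) (ℕP.+-identityʳ t))

-- Past an index k with Fₖ > 2|b| the Cassini error term 4(-1)ᵏ b² is dominated.
fibLucas-pos-b>0 : ∀ s B → s ℤ.< + 0 → s ℤ.* s ℤ.< + 5 ℤ.* (+ B ℤ.* + B) → Eventually (λ j → + 0 ℤ.< fibLucas s (+ B) j)
fibLucas-pos-b>0 s B s<0 s²<5b² = fibLucas-persists s b k (at k gap-k gap-k-pos) (at (suc k) gap-k+1 gap-k+1-pos)
  where
  b = + B
  k = suc (double (suc B))
  F = fibℤ k
  F' = fibℤ (suc k)
  D = + 5 ℤ.* (b ℤ.* b) ℤ.- (+ 1 ℤ.+ s ℤ.* s)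
  0≤D : + 0 ℤ.≤ D
  0≤D = i<j⇒0≤j-suc[i] s²<5b²
  0≤b : + 0 ℤ.≤ b
  0≤b = +≤+ z≤n
  at : ∀ i {g} → (b ℤ.* b) ℤ.* (+ 5 ℤ.* (fibℤ i ℤ.* fibℤ i) ℤ.+ + 4 ℤ.* minus1^ i) ℤ.- (s ℤ.* s) ℤ.* (fibℤ i ℤ.* fibℤ i) ≡ g →
       + 0 ℤ.< g → + 0 ℤ.< fibLucas s b i
  at i gap 0<g = fibLucas-pos-of-squares s b i (ℤP.<⇒≤ s<0) 0≤b (subst (+ 0 ℤ.<_) (sym gap) 0<g)
  identity₁ : ∀ (s b F : ℤ) → (b ℤ.* b) ℤ.* (+ 5 ℤ.* (F ℤ.* F) ℤ.+ + 4 ℤ.* ℤ.- (+ 1)) ℤ.- (s ℤ.* s) ℤ.* (F ℤ.* F)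
              ≡ (+ 5 ℤ.* (b ℤ.* b) ℤ.- (+ 1 ℤ.+ s ℤ.* s)) ℤ.* (F ℤ.* F) ℤ.+ (F ℤ.- (b ℤ.+ b)) ℤ.* (F ℤ.+ (b ℤ.+ b))
  identity₁ = solve-∀
  identity₂ : ∀ (s b F : ℤ) → (b ℤ.* b) ℤ.* (+ 5 ℤ.* (F ℤ.* F) ℤ.+ + 4 ℤ.* + 1) ℤ.- (s ℤ.* s) ℤ.* (F ℤ.* F)
              ≡ (F ℤ.* F) ℤ.+ ((+ 5 ℤ.* (b ℤ.* b) ℤ.- (+ 1 ℤ.+ s ℤ.* s)) ℤ.* (F ℤ.* F) ℤ.+ + 4 ℤ.* (b ℤ.* b))
  identity₂ = solve-∀
  gap-k = trans (cong (λ w → (b ℤ.* b) ℤ.* (+ 5 ℤ.* (F ℤ.* F) ℤ.+ + 4 ℤ.* w) ℤ.- (s ℤ.* s) ℤ.* (F ℤ.* F)) (minus1^-odd (suc B)))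
                (identity₁ s b F)
  gap-k-pos : + 0 ℤ.< D ℤ.* (F ℤ.* F) ℤ.+ (F ℤ.- (b ℤ.+ b)) ℤ.* (F ℤ.+ (b ℤ.+ b))
  gap-k-pos = ℤP.+-mono-≤-< (0≤-* 0≤D (0≤-square F))
                (0<-* (i<j⇒0<j-i (2t<fib B)) (ℤP.+-mono-<-≤ (fibℤ-pos (double (suc B))) (ℤP.+-mono-≤ 0≤b 0≤b)))
  gap-k+1 = trans (cong (λ w → (b ℤ.* b) ℤ.* (+ 5 ℤ.* (F' ℤ.* F') ℤ.+ + 4 ℤ.* w) ℤ.- (s ℤ.* s) ℤ.* (F' ℤ.* F')) (minus1^-even (suc (suc B))))
                  (identity₂ s b F')
  gap-k+1-pos : + 0 ℤ.< F' ℤ.* F' ℤ.+ (D ℤ.* (F' ℤ.* F') ℤ.+ + 4 ℤ.* (b ℤ.* b))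
  gap-k+1-pos = ℤP.+-mono-<-≤ (0<-* (fibℤ-pos k) (fibℤ-pos k)) (ℤP.+-mono-≤ (0≤-* 0≤D (0≤-square F')) (0≤-* {+ 4} (+≤+ z≤n) (0≤-square b)))

fibLucas-pos-b<0 : ∀ s B → + 0 ℤ.< s → + 5 ℤ.* ((ℤ.- (+ B)) ℤ.* (ℤ.- (+ B))) ℤ.< s ℤ.* s →
                   Eventually (λ j → + 0 ℤ.< fibLucas s (ℤ.- (+ B)) j)
fibLucas-pos-b<0 s B 0<s 5b²<s² = fibLucas-persists s b k (at k gap-k gap-k-pos) (at (suc k) gap-k+1 gap-k+1-pos)
  where
  b = ℤ.- (+ B)
  k = double (suc (suc B))
  F = fibℤ k
  F' = fibℤ (suc k)
  D = s ℤ.* s ℤ.- (+ 1 ℤ.+ + 5 ℤ.* (b ℤ.* b))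
  0≤D : + 0 ℤ.≤ D
  0≤D = i<j⇒0≤j-suc[i] 5b²<s²
  0≤B : + 0 ℤ.≤ + B
  0≤B = +≤+ z≤n
  at : ∀ i {g} → (s ℤ.* s) ℤ.* (fibℤ i ℤ.* fibℤ i) ℤ.- (b ℤ.* b) ℤ.* (+ 5 ℤ.* (fibℤ i ℤ.* fibℤ i) ℤ.+ + 4 ℤ.* minus1^ i) ≡ g →
       + 0 ℤ.< g → + 0 ℤ.< fibLucas s b i
  at i gap 0<g = fibLucas-pos-of-squares′ s b i (ℤP.<⇒≤ 0<s) (ℤP.neg-mono-≤ 0≤B) (subst (+ 0 ℤ.<_) (sym gap) 0<g)
  identity₁ : ∀ (s B F : ℤ) → (s ℤ.* s) ℤ.* (F ℤ.* F) ℤ.- (ℤ.- B ℤ.* ℤ.- B) ℤ.* (+ 5 ℤ.* (F ℤ.* F) ℤ.+ + 4 ℤ.* + 1)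
              ≡ (s ℤ.* s ℤ.- (+ 1 ℤ.+ + 5 ℤ.* (ℤ.- B ℤ.* ℤ.- B))) ℤ.* (F ℤ.* F) ℤ.+ (F ℤ.- (B ℤ.+ B)) ℤ.* (F ℤ.+ (B ℤ.+ B))
  identity₁ = solve-∀
  identity₂ : ∀ (s b F : ℤ) → (s ℤ.* s) ℤ.* (F ℤ.* F) ℤ.- (b ℤ.* b) ℤ.* (+ 5 ℤ.* (F ℤ.* F) ℤ.+ + 4 ℤ.* ℤ.- (+ 1))
              ≡ (F ℤ.* F) ℤ.+ ((s ℤ.* s ℤ.- (+ 1 ℤ.+ + 5 ℤ.* (b ℤ.* b))) ℤ.* (F ℤ.* F) ℤ.+ + 4 ℤ.* (b ℤ.* b))
  identity₂ = solve-∀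
  gap-k = trans (cong (λ w → (s ℤ.* s) ℤ.* (F ℤ.* F) ℤ.- (b ℤ.* b) ℤ.* (+ 5 ℤ.* (F ℤ.* F) ℤ.+ + 4 ℤ.* w)) (minus1^-even (suc (suc B))))
                (identity₁ s (+ B) F)
  2B<F : + B ℤ.+ + B ℤ.< F
  2B<F = ℤP.<-≤-trans (2t<fib B) (+≤+ (fib-≤-suc (suc (double (suc B)))))
  gap-k-pos : + 0 ℤ.< D ℤ.* (F ℤ.* F) ℤ.+ (F ℤ.- (+ B ℤ.+ + B)) ℤ.* (F ℤ.+ (+ B ℤ.+ + B))
  gap-k-pos = ℤP.+-mono-≤-< (0≤-* 0≤D (0≤-square F))
                (0<-* (i<j⇒0<j-i 2B<F) (ℤP.+-mono-<-≤ (fibℤ-pos (suc (double (suc B)))) (ℤP.+-mono-≤ 0≤B 0≤B)))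
  gap-k+1 = trans (cong (λ w → (s ℤ.* s) ℤ.* (F' ℤ.* F') ℤ.- (b ℤ.* b) ℤ.* (+ 5 ℤ.* (F' ℤ.* F') ℤ.+ + 4 ℤ.* w)) (minus1^-odd (suc (suc B))))
                  (identity₂ s b F')
  gap-k+1-pos : + 0 ℤ.< F' ℤ.* F' ℤ.+ (D ℤ.* (F' ℤ.* F') ℤ.+ + 4 ℤ.* (b ℤ.* b))
  gap-k+1-pos = ℤP.+-mono-<-≤ (0<-* (fibℤ-pos k) (fibℤ-pos k)) (ℤP.+-mono-≤ (0≤-* 0≤D (0≤-square F')) (0≤-* {+ 4} (+≤+ z≤n) (0≤-square b)))

Posφ⇒0≺ : ∀ x → Posφ x → 0φ ≺ x
Posφ⇒0≺ (a +φ* b) pos = mk≺ (Eventually-map (λ {j} p →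
    subst (ℤ._< coeff j (a +φ* b)) (coeff-0φ j) (half (subst (+ 0 ℤ.<_) (fibLucas≡2coeff a b j) p)))
  (by-cases pos))
  where
  s = + 2 ℤ.* a ℤ.+ b
  half : ∀ {g : ℤ} → + 0 ℤ.< g ℤ.+ g → + 0 ℤ.< g
  half {g} 0<2g with + 0 ℤ.<? g
  ... | yes 0<g = 0<g
  ... | no 0≮g = ⊥-elim (ℤP.<⇒≱ 0<2g (ℤP.+-mono-≤ (ℤP.≮⇒≥ 0≮g) (ℤP.≮⇒≥ 0≮g)))
  by-cases : Pos√5 s b → Eventually (λ j → + 0 ℤ.< fibLucas s b j)
  by-cases (inj₁ (0≤s , 0≤b , one-pos)) = fibLucas-pos-nonneg s b 0≤s 0≤b one-pos
  by-cases (inj₂ (inj₁ (s<0 , 0<b , s²<5b²))) = b-pos b 0<b s²<5b²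
    where
    b-pos : ∀ b → + 0 ℤ.< b → s ℤ.* s ℤ.< + 5 ℤ.* (b ℤ.* b) → Eventually (λ j → + 0 ℤ.< fibLucas s b j)
    b-pos (+ B) _ s²<5b² = fibLucas-pos-b>0 s B s<0 s²<5b²
  by-cases (inj₂ (inj₂ (0<s , b<0 , 5b²<s²))) = b-neg b b<0 5b²<s²
    where
    b-neg : ∀ b → b ℤ.< + 0 → + 5 ℤ.* (b ℤ.* b) ℤ.< s ℤ.* s → Eventually (λ j → + 0 ℤ.< fibLucas s b j)
    b-neg -[1+ B ] _ 5b²<s² = fibLucas-pos-b<0 s (suc B) 0<s 5b²<s²
    b-neg (+ _) (+<+ ()) _

<φ⇒≺ : ∀ {x y} → x <φ y → x ≺ y
<φ⇒≺ {x} {y} x<y = ≺-by-difference {a = 0φ} {b = y ⊖ x} (sym (⊖-identityʳ (y ⊖ x))) (Posφ⇒0≺ (y ⊖ x) x<y)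

≤φ⇒≼ : ∀ {x y} → x ≤φ y → x ≼ y
≤φ⇒≼ (inj₁ x<y) = ≺⇒≼ (<φ⇒≺ x<y)
≤φ⇒≼ (inj₂ refl) = ≼-refl

-- Integer coordinates from real bounds: a violated integer inequality is refuted by coeff at one large index.

coeff-pos : ∀ {x} → 0φ ≺ x → Eventually (λ j → + 0 ℤ.< coeff j x)
coeff-pos {x} (mk≺ p) = Eventually-map (λ {j} → subst (ℤ._< coeff j x) (coeff-0φ j)) p

coeff-difference-pos : ∀ {x y} → x ≺ y → Eventually (λ j → + 0 ℤ.< coeff j (y ⊖ x))
coeff-difference-pos {x} {y} (mk≺ p) = Eventually-map (λ {j} x<y → subst (+ 0 ℤ.<_) (sym (coeff-⊖ j y x)) (i<j⇒0<j-i x<y)) p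

Eventually-at≥2 : ∀ {P : ℕ → Set} → Eventually P → ∃ λ j → P j × 2 ≤ j
Eventually-at≥2 p = Eventually-witness (Eventually-zip _,_ p (Eventually-≤ 2))

fibℤ-fibℤ-suc≤0 : ∀ j → fibℤ j ℤ.- fibℤ (suc j) ℤ.≤ + 0
fibℤ-fibℤ-suc≤0 j = subst (fibℤ j ℤ.- fibℤ (suc j) ℤ.≤_) (ℤP.+-inverseʳ (fibℤ (suc j)))
                      (ℤP.+-monoˡ-≤ (ℤ.- fibℤ (suc j)) (+≤+ (fib-≤-suc j)))

coeff-mono-≤ : ∀ {a a' b b'} j → a ℤ.≤ a' → b ℤ.≤ b' → coeff j (a +φ* b) ℤ.≤ coeff j (a' +φ* b')
coeff-mono-≤ j a≤a' b≤b' = ℤP.+-mono-≤ (*-monoʳ-≤ (+≤+ z≤n) a≤a') (*-monoʳ-≤ (+≤+ z≤n) b≤b')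

coeff-c-c≤0 : ∀ {c} j → + 0 ℤ.≤ c → coeff j (c +φ* ℤ.- c) ℤ.≤ + 0
coeff-c-c≤0 {c} j 0≤c = subst (ℤ._≤ + 0) (identity c (fibℤ j) (fibℤ (suc j))) (*-monoʳ-≤ 0≤c (fibℤ-fibℤ-suc≤0 j))
  where
  identity : ∀ (c f g : ℤ) → (f ℤ.- g) ℤ.* c ≡ c ℤ.* f ℤ.+ (ℤ.- c) ℤ.* g
  identity = solve-∀

coeff-3-2≤0 : ∀ j → 2 ≤ j → coeff j (+ 3 +φ* ℤ.- + 2) ℤ.≤ + 0
coeff-3-2≤0 (suc zero) (s≤s ())
coeff-3-2≤0 (suc (suc i)) _ = subst (ℤ._≤ + 0) (sym (trans (cong₂ (λ u w → + 3 ℤ.* u ℤ.+ ℤ.- (+ 2) ℤ.* w)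
    (fibℤ-rec i) (trans (fibℤ-rec (suc i)) (cong (ℤ._+ fibℤ (suc i)) (fibℤ-rec i)))) (identity (fibℤ i) (fibℤ (suc i)))))
  (fibℤ-fibℤ-suc≤0 i)
  where identity : ∀ (f g : ℤ) → + 3 ℤ.* (g ℤ.+ f) ℤ.+ ℤ.- (+ 2) ℤ.* ((g ℤ.+ f) ℤ.+ g) ≡ f ℤ.- g
        identity = solve-∀

im-nonneg : ∀ a b → 0φ ≺ a +φ* b → conj (a +φ* b) ≺ + 1 +φ* + 1 → + 0 ℤ.≤ b
im-nonneg a b 0≺x conj≺ with b ℤ.<? + 0
... | no b≮0 = ℤP.≮⇒≥ b≮0
... | yes b<0 = ⊥-elim (contradiction 2≤a)
  where
  c = + 0 ℤ.- (+ 1 ℤ.+ b)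
  0≤c : + 0 ℤ.≤ c
  0≤c = i<j⇒0≤j-suc[i] b<0
  b≤-1 : b ℤ.≤ ℤ.- (+ 1)
  b≤-1 = ≤-by-nonneg c 0≤c (identity b)
    where identity : ∀ (b : ℤ) → ℤ.- (+ 1) ≡ b ℤ.+ (+ 0 ℤ.- (+ 1 ℤ.+ b))
          identity = solve-∀
  2≤a : + 2 ℤ.≤ a
  2≤a with + 2 ℤ.≤? a
  ... | yes 2≤a = 2≤a
  ... | no 2≰a with Eventually-at≥2 (coeff-pos 0≺x)
  ...   | j , (0<x , _) = ⊥-elim (ℤP.<⇒≱ 0<x
      (ℤP.≤-trans (coeff-mono-≤ j a≤1 b≤-1) (coeff-c-c≤0 {+ 1} j (+≤+ z≤n))))
    where
    a≤1 : a ℤ.≤ + 1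
    a≤1 = ≤-by-nonneg (+ 2 ℤ.- (+ 1 ℤ.+ a)) (i<j⇒0≤j-suc[i] (ℤP.≰⇒> 2≰a)) (identity a)
      where identity : ∀ (a : ℤ) → + 1 ≡ a ℤ.+ (+ 2 ℤ.- (+ 1 ℤ.+ a))
            identity = solve-∀
  contradiction : + 2 ℤ.≤ a → ⊥
  contradiction 2≤a with Eventually-at≥2 (coeff-difference-pos conj≺)
  ... | j , (0<d , _) = ℤP.<⇒≱ 0<d (ℤP.≤-trans (coeff-mono-≤ j re≤ (ℤP.≤-reflexive (identity₂ b))) (coeff-c-c≤0 j 0≤c))
    where
    identity₁ : ∀ (a b : ℤ) → (+ 0 ℤ.- (+ 1 ℤ.+ b)) ≡ (+ 1 ℤ.- (a ℤ.+ b)) ℤ.+ (a ℤ.- + 2)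
    identity₁ = solve-∀
    identity₂ : ∀ (b : ℤ) → + 1 ℤ.- ℤ.- b ≡ ℤ.- (+ 0 ℤ.- (+ 1 ℤ.+ b))
    identity₂ = solve-∀
    re≤ : + 1 ℤ.- (a ℤ.+ b) ℤ.≤ c
    re≤ = ≤-by-nonneg (a ℤ.- + 2) (ℤP.i≤j⇒0≤j-i 2≤a) (identity₁ a b)

im-≤1 : ∀ a b → a +φ* b ≺ ι (+ 2) → negφ (+ 1 +φ* + 1) ≺ conj (a +φ* b) → b ℤ.≤ + 1
im-≤1 a b x≺2 ≺conj with + 1 ℤ.<? b
... | no 1≮b = ℤP.≮⇒≥ 1≮b
... | yes 1<b = ⊥-elim (contradiction a≤-2)
  where
  0≤b-2 : + 0 ℤ.≤ b ℤ.- + 2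
  0≤b-2 = i<j⇒0≤j-suc[i] 1<b
  a≤-2 : a ℤ.≤ ℤ.- (+ 2)
  a≤-2 with a ℤ.≤? ℤ.- (+ 2)
  ... | yes a≤-2 = a≤-2
  ... | no a≰-2 with Eventually-at≥2 (coeff-difference-pos x≺2)
  ...   | j , (0<d , 2≤j) = ⊥-elim (ℤP.<⇒≱ 0<d (ℤP.≤-trans (coeff-mono-≤ j re≤ im≤) (coeff-3-2≤0 j 2≤j)))
    where
    identity₁ : ∀ (a : ℤ) → + 3 ≡ (+ 2 ℤ.- a) ℤ.+ (a ℤ.- ℤ.- (+ 1))
    identity₁ = solve-∀
    identity₂ : ∀ (b : ℤ) → ℤ.- (+ 2) ≡ (+ 0 ℤ.- b) ℤ.+ (b ℤ.- + 2)
    identity₂ = solve-∀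
    re≤ : + 2 ℤ.- a ℤ.≤ + 3
    re≤ = ≤-by-nonneg (a ℤ.- ℤ.- (+ 1)) (ℤP.i≤j⇒0≤j-i (ℤP.i<j⇒suc[i]≤j (ℤP.≰⇒> a≰-2))) (identity₁ a)
    im≤ : + 0 ℤ.- b ℤ.≤ ℤ.- (+ 2)
    im≤ = ≤-by-nonneg (b ℤ.- + 2) 0≤b-2 (identity₂ b)
  contradiction : a ℤ.≤ ℤ.- (+ 2) → ⊥
  contradiction a≤-2 with Eventually-at≥2 (coeff-difference-pos ≺conj)
  ... | j , (0<d , _) = ℤP.<⇒≱ 0<d (ℤP.≤-trans (coeff-mono-≤ j re≤ (ℤP.≤-reflexive (identity₃ b))) (coeff-c-c≤0 j 0≤b-1))
    where
    identity₁ : ∀ (b : ℤ) → b ℤ.- + 1 ≡ (b ℤ.- + 2) ℤ.+ + 1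
    identity₁ = solve-∀
    identity₂ : ∀ (a b : ℤ) → b ℤ.- + 1 ≡ ((a ℤ.+ b) ℤ.- ℤ.- (+ 1)) ℤ.+ (ℤ.- (+ 2) ℤ.- a)
    identity₂ = solve-∀
    identity₃ : ∀ (b : ℤ) → (ℤ.- b) ℤ.- ℤ.- (+ 1) ≡ ℤ.- (b ℤ.- + 1)
    identity₃ = solve-∀
    0≤b-1 : + 0 ℤ.≤ b ℤ.- + 1
    0≤b-1 = ℤP.≤-trans 0≤b-2 (≤-by-nonneg (+ 1) (+≤+ z≤n) (identity₁ b))
    re≤ : (a ℤ.+ b) ℤ.- ℤ.- (+ 1) ℤ.≤ b ℤ.- + 1
    re≤ = ≤-by-nonneg (ℤ.- (+ 2) ℤ.- a) (ℤP.i≤j⇒0≤j-i a≤-2) (identity₂ a b)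

re-≥1 : ∀ d → negφ 1φ ≺ d +φ* ℤ.- (+ 1) → + 1 ℤ.≤ d
re-≥1 d -1≺ with + 1 ℤ.≤? d
... | yes 1≤d = 1≤d
... | no 1≰d with Eventually-at≥2 (coeff-difference-pos -1≺)
...   | j , (0<d , _) = ⊥-elim (ℤP.<⇒≱ 0<d (ℤP.≤-trans (coeff-mono-≤ {b' = ℤ.- (+ 1)} j re≤ ℤP.≤-refl) (coeff-c-c≤0 {+ 1} j (+≤+ z≤n))))
  where
  identity : ∀ (d : ℤ) → + 1 ≡ (d ℤ.- ℤ.- (+ 1)) ℤ.+ (+ 1 ℤ.- (+ 1 ℤ.+ d))
  identity = solve-∀
  re≤ : d ℤ.- ℤ.- (+ 1) ℤ.≤ + 1
  re≤ = ≤-by-nonneg (+ 1 ℤ.- (+ 1 ℤ.+ d)) (i<j⇒0≤j-suc[i] (ℤP.≰⇒> 1≰d)) (identity d)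

conj-pos : ∀ d → + 1 ℤ.≤ d → 0φ ≺ conj (d +φ* ℤ.- (+ 1))
conj-pos d 1≤d = mk≺ (0 , λ j _ → subst (ℤ._< coeff j (conj (d +φ* ℤ.- (+ 1)))) (sym (coeff-0φ j))
  (ℤP.<-≤-trans (fibℤ-pos j) (≤-by-nonneg ((d ℤ.+ ℤ.- (+ 1)) ℤ.* fibℤ j)
    (0≤-* (ℤP.i≤j⇒0≤j-i 1≤d) (+≤+ z≤n)) (identity d (fibℤ j) (fibℤ (suc j))))))
  where
  identity : ∀ (d f g : ℤ) → (d ℤ.+ ℤ.- (+ 1)) ℤ.* f ℤ.+ ℤ.- (ℤ.- (+ 1)) ℤ.* g ≡ g ℤ.+ (d ℤ.+ ℤ.- (+ 1)) ℤ.* f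
  identity = solve-∀

-- Digit strings

bit : Bool → Zφ
bit true = 1φ
bit false = 0φ

-- The value Σ dᵢ φⁱ of the digit string d₀ d₁ d₂ … (lowest digit first).
digitSum : List Bool → Zφ
digitSum [] = 0φ
digitSum (d ∷ ds) = bit d ⊕ mulφ (digitSum ds)

digitSum-false : ∀ ds → digitSum (false ∷ ds) ≡ mulφ (digitSum ds)
digitSum-false ds = ⊕-identityˡ (mulφ (digitSum ds))

digitSum-++ : ∀ xs ys → digitSum (xs ++ ys) ≡ digitSum xs ⊕ scaleφ (length xs) (digitSum ys)
digitSum-++ [] ys = sym (⊕-identityˡ (digitSum ys))
digitSum-++ (d ∷ xs) ys = begin
  bit d ⊕ mulφ (digitSum (xs ++ ys))
    ≡⟨ cong (λ z → bit d ⊕ mulφ z) (digitSum-++ xs ys) ⟩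
  bit d ⊕ mulφ (digitSum xs ⊕ scaleφ (length xs) (digitSum ys))
    ≡⟨ cong (bit d ⊕_) (mulφ-⊕ (digitSum xs) _) ⟩
  bit d ⊕ (mulφ (digitSum xs) ⊕ scaleφ (suc (length xs)) (digitSum ys))
    ≡⟨ sym (⊕-assoc (bit d) (mulφ (digitSum xs)) _) ⟩
  digitSum (d ∷ xs) ⊕ scaleφ (length (d ∷ xs)) (digitSum ys)
    ∎
  where open ≡-Reasoning

digitSum-replicate-false : ∀ z ys → digitSum (replicate z false ++ ys) ≡ scaleφ z (digitSum ys)
digitSum-replicate-false zero ys = refl
digitSum-replicate-false (suc z) ys =
  trans (digitSum-false (replicate z false ++ ys)) (cong mulφ (digitSum-replicate-false z ys))

digitSum-∷ʳ : ∀ xs d → digitSum (xs ++ [ d ]) ≡ digitSum xs ⊕ scaleφ (length xs) (bit d)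
digitSum-∷ʳ xs d = trans (digitSum-++ xs [ d ]) (cong (λ z → digitSum xs ⊕ scaleφ (length xs) z) (⊕-identityʳ (bit d)))

sumPos≡scaleφ-digitSum : ∀ i ds → sumPos i ds ≡ scaleφ i (digitSum ds)
sumPos≡scaleφ-digitSum i [] = sym (scaleφ-0φ i)
sumPos≡scaleφ-digitSum i (true ∷ ds) =
  trans (cong₂ _⊕_ (φ^≡scaleφ i) (trans (sumPos≡scaleφ-digitSum (suc i) ds) (sym (scaleφ-mulφ i (digitSum ds)))))
        (sym (scaleφ-⊕ i 1φ (mulφ (digitSum ds))))
sumPos≡scaleφ-digitSum i (false ∷ ds) =
  trans (sumPos≡scaleφ-digitSum (suc i) ds)
        (trans (sym (scaleφ-mulφ i (digitSum ds))) (cong (scaleφ i) (sym (digitSum-false ds))))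

scaleφ-sumNeg : ∀ ds i → scaleφ (i ℕ.+ length ds) (sumNeg i ds) ≡ digitSum (reverse ds)
scaleφ-sumNeg [] i = scaleφ-0φ _
scaleφ-sumNeg (d ∷ ds) i =
  trans (cong (λ k → scaleφ k (sumNeg i (d ∷ ds))) (ℕP.+-suc i (length ds))) (lowest d)
  where
  L = length ds
  ih : scaleφ (suc i ℕ.+ L) (sumNeg (suc i) ds) ≡ digitSum (reverse ds)
  ih = scaleφ-sumNeg ds (suc i)
  reverse-∷ : ∀ d → digitSum (reverse (d ∷ ds)) ≡ digitSum (reverse ds) ⊕ scaleφ L (bit d)
  reverse-∷ d = trans (cong digitSum (ListP.unfold-reverse d ds))
    (trans (digitSum-∷ʳ (reverse ds) d) (cong (λ k → digitSum (reverse ds) ⊕ scaleφ k (bit d)) (ListP.length-reverse ds)))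
  lowest : ∀ d → scaleφ (suc i ℕ.+ L) (sumNeg i (d ∷ ds)) ≡ digitSum (reverse (d ∷ ds))
  lowest true = begin
    scaleφ (suc i ℕ.+ L) (φ^- (suc i) ⊕ sumNeg (suc i) ds)
      ≡⟨ scaleφ-⊕ (suc i ℕ.+ L) (φ^- (suc i)) _ ⟩
    scaleφ (suc i ℕ.+ L) (φ^- (suc i)) ⊕ scaleφ (suc i ℕ.+ L) (sumNeg (suc i) ds)
      ≡⟨ cong₂ _⊕_ (scaleφ-φ^- (suc i) L) ih ⟩
    φ^ L ⊕ digitSum (reverse ds)
      ≡⟨ ⊕-comm (φ^ L) _ ⟩
    digitSum (reverse ds) ⊕ φ^ L
      ≡⟨ cong (digitSum (reverse ds) ⊕_) (φ^≡scaleφ L) ⟩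
    digitSum (reverse ds) ⊕ scaleφ L 1φ
      ≡⟨ sym (reverse-∷ true) ⟩
    digitSum (reverse (true ∷ ds))
      ∎
    where open ≡-Reasoning
  lowest false = trans ih (trans (sym (⊕-identityʳ _))
    (trans (cong (digitSum (reverse ds) ⊕_) (sym (scaleφ-0φ L))) (sym (reverse-∷ false))))

scaleφ-value : ∀ e → scaleφ (length (neg e)) (value e) ≡ digitSum (reverse (neg e) ++ pos e)
scaleφ-value e = begin
  scaleφ r (sumPos 0 (pos e) ⊕ sumNeg 0 (neg e))
    ≡⟨ scaleφ-⊕ r (sumPos 0 (pos e)) (sumNeg 0 (neg e)) ⟩
  scaleφ r (sumPos 0 (pos e)) ⊕ scaleφ r (sumNeg 0 (neg e))
    ≡⟨ cong₂ _⊕_ (cong (scaleφ r) (sumPos≡scaleφ-digitSum 0 (pos e))) (scaleφ-sumNeg (neg e) 0) ⟩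
  scaleφ r (digitSum (pos e)) ⊕ digitSum (reverse (neg e))
    ≡⟨ ⊕-comm (scaleφ r (digitSum (pos e))) (digitSum (reverse (neg e))) ⟩
  digitSum (reverse (neg e)) ⊕ scaleφ r (digitSum (pos e))
    ≡⟨ cong (λ k → digitSum (reverse (neg e)) ⊕ scaleφ k (digitSum (pos e))) (sym (ListP.length-reverse (neg e))) ⟩
  digitSum (reverse (neg e)) ⊕ scaleφ (length (reverse (neg e))) (digitSum (pos e))
    ≡⟨ sym (digitSum-++ (reverse (neg e)) (pos e)) ⟩
  digitSum (reverse (neg e) ++ pos e)
    ∎
  where open ≡-Reasoning
        r = length (neg e)

digitSum-prefix : ∀ u ps x → scaleφ (length u) x ≡ digitSum (u ++ ps) → digitSum u ≡ scaleφ (length u) (x ⊖ digitSum ps)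
digitSum-prefix u ps x scaled = begin
  digitSum u                               ≡⟨ sym (⊕-⊖-cancel (digitSum u) S) ⟩
  (digitSum u ⊕ S) ⊖ S                     ≡⟨ cong (_⊖ S) (sym (trans scaled (digitSum-++ u ps))) ⟩
  scaleφ (length u) x ⊖ S                  ≡⟨ sym (scaleφ-⊖ (length u) x (digitSum ps)) ⟩
  scaleφ (length u) (x ⊖ digitSum ps)      ∎
  where
  open ≡-Reasoning
  S = scaleφ (length u) (digitSum ps)

No11-++ˡ : ∀ xs {ys} → No11 (xs ++ ys) → No11 xs
No11-++ˡ [] _ = []
No11-++ˡ (x ∷ []) _ = [-]
No11-++ˡ (x ∷ y ∷ xs) (r ∷ h) = r ∷ No11-++ˡ (y ∷ xs) h

No11-++ʳ : ∀ xs {ys} → No11 (xs ++ ys) → No11 ys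
No11-++ʳ [] h = h
No11-++ʳ (x ∷ xs) h = No11-++ʳ xs (Linked.tail h)

-- conj (Σ dᵢ φⁱ) = Σ dᵢ (-φ)⁻ⁱ

Between : Zφ → Zφ → Zφ → Set
Between a x b = a ≺ x × x ≺ b

-1≺0 : negφ 1φ ≺ 0φ
-1≺0 = ≺-by-difference {a = 0φ} {b = 1φ} refl (0≺φ^ 0)

0≺φ : 0φ ≺ φ^ 1
0≺φ = 0≺φ^ 1

-1≺φ⁻¹ : negφ 1φ ≺ φ^- 1
-1≺φ⁻¹ = ≺-by-difference {a = 0φ} {b = φ^ 1} refl (0≺φ^ 1)

φ⁻¹≺φ : φ^- 1 ≺ φ^ 1
φ⁻¹≺φ = ≺-by-difference {a = 0φ} {b = 1φ} refl (0≺φ^ 0)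

φ⁻¹≺1 : φ^- 1 ≺ 1φ
φ⁻¹≺1 = ≺-by-difference {a = 0φ} {b = φ^- 2} refl (0≺φ^- 2)

1≺φ : 1φ ≺ φ^ 1
1≺φ = ≺-by-difference {a = 0φ} {b = φ^- 1} refl (0≺φ^- 1)

φ≺2 : φ^ 1 ≺ ι (+ 2)
φ≺2 = ≺-by-difference {a = 0φ} {b = φ^- 2} refl (0≺φ^- 2)

conj-digitSum-∷ : ∀ d ds → conj (digitSum (d ∷ ds)) ≡ bit d ⊕ negφ (mulφ⁻¹ (conj (digitSum ds)))
conj-digitSum-∷ d ds = trans (conj-⊕ (bit d) (mulφ (digitSum ds))) (cong₂ _⊕_ (conj-bit d) (conj-mulφ (digitSum ds)))
  where conj-bit : ∀ d → conj (bit d) ≡ bit d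
        conj-bit true = refl
        conj-bit false = refl

conj-digitSum-false-step : ∀ ds → Between (negφ 1φ) (conj (digitSum ds)) (φ^ 1) →
                           Between (negφ 1φ) (conj (digitSum (false ∷ ds))) (φ^- 1)
conj-digitSum-false-step ds (lo , hi) =
  subst (λ z → Between (negφ 1φ) z (φ^- 1)) (sym (trans (conj-digitSum-∷ false ds) (⊕-identityˡ _)))
        (flip-antimono-≺ hi , flip-antimono-≺ lo)

conj-digitSum-bounds : ∀ ds → No11 ds → Between (negφ 1φ) (conj (digitSum ds)) (φ^ 1)
conj-digitSum-true-bounds : ∀ ds → No11 (true ∷ ds) → Between (φ^- 1) (conj (digitSum (true ∷ ds))) (φ^ 1)

conj-digitSum-false-bounds : ∀ ds → No11 (false ∷ ds) → Between (negφ 1φ) (conj (digitSum (false ∷ ds))) (φ^- 1)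
conj-digitSum-false-bounds ds h = conj-digitSum-false-step ds (conj-digitSum-bounds ds (Linked.tail h))

conj-digitSum-bounds [] _ = -1≺0 , 0≺φ
conj-digitSum-bounds (false ∷ ds) h =
  let lo , hi = conj-digitSum-false-bounds ds h in lo , ≺-trans hi φ⁻¹≺φ
conj-digitSum-bounds (true ∷ ds) h =
  let lo , hi = conj-digitSum-true-bounds ds h in ≺-trans -1≺φ⁻¹ lo , hi

conj-digitSum-true-bounds [] _ =
  subst (λ z → Between (φ^- 1) z (φ^ 1)) (sym (conj-digitSum-∷ true [])) (φ⁻¹≺1 , 1≺φ)
conj-digitSum-true-bounds (true ∷ ds) (() ∷ _)
conj-digitSum-true-bounds (false ∷ ds) (_ ∷ h) =
  subst (λ z → Between (φ^- 1) z (φ^ 1)) (sym (conj-digitSum-∷ true (false ∷ ds)))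
        (⊕-monoʳ-≺ 1φ (flip-antimono-≺ hi) , ⊕-monoʳ-≺ 1φ (flip-antimono-≺ lo))
  where
  lo-hi = conj-digitSum-false-bounds ds h
  lo = proj₁ lo-hi
  hi = proj₂ lo-hi

digitSum-nonneg : ∀ ds → 0φ ≼ digitSum ds
digitSum-nonneg [] = ≼-refl
digitSum-nonneg (d ∷ ds) =
  ≼-respˡ (⊕-identityˡ 0φ) (⊕-mono-≼ (bit-nonneg d) (≼-respˡ (scaleφ-0φ 1) (mulφ-mono-≼ (digitSum-nonneg ds))))
  where bit-nonneg : ∀ d → 0φ ≼ bit d
        bit-nonneg true = ≺⇒≼ (0≺φ^ 0)
        bit-nonneg false = ≼-refl

digitSum-bound : ∀ ds → No11 ds → digitSum ds ⊕ φ^- 1 ≼ φ^ (length ds)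
digitSum-bound [] _ = ≺⇒≼ φ⁻¹≺1
digitSum-bound (false ∷ ds) h =
  ≼-by-difference {a = mulφ (digitSum ds ⊕ φ^- 1) ⊕ φ^- 1} {b = mulφ (φ^ (length ds)) ⊕ 1φ}
    (Zφ-≡ (identity-re (re S) (im S) (re P) (im P)) (identity-im (re S) (im S) (re P) (im P)))
    (⊕-mono-≼ (mulφ-mono-≼ (digitSum-bound ds (Linked.tail h))) (≺⇒≼ φ⁻¹≺1))
  where
  S = digitSum ds
  P = φ^ (length ds)
  identity-re : ∀ (a b c d : ℤ) → (d ℤ.- (((+ 0) ℤ.+ b) ℤ.+ ((+ 0) ℤ.- (+ 1))))
                ≡ ((d ℤ.+ (+ 1)) ℤ.- ((b ℤ.+ (+ 1)) ℤ.+ ((+ 0) ℤ.- (+ 1))))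
  identity-re = solve-∀
  identity-im : ∀ (a b c d : ℤ) → ((c ℤ.+ d) ℤ.- (((+ 0) ℤ.+ (a ℤ.+ b)) ℤ.+ (+ 1)))
                ≡ (((c ℤ.+ d) ℤ.+ (+ 0)) ℤ.- (((a ℤ.+ ((+ 0) ℤ.- (+ 1))) ℤ.+ (b ℤ.+ (+ 1))) ℤ.+ (+ 1)))
  identity-im = solve-∀
digitSum-bound (true ∷ []) _ = ≼-refl
digitSum-bound (true ∷ true ∷ ds) (() ∷ _)
digitSum-bound (true ∷ false ∷ ds) (_ ∷ h) =
  ≼-by-difference {a = mulφ (mulφ (digitSum ds ⊕ φ^- 1))} {b = mulφ (mulφ (φ^ (length ds)))}
    (Zφ-≡ (identity-re (re S) (im S) (re P) (im P)) (identity-im (re S) (im S) (re P) (im P)))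
    (mulφ-mono-≼ (mulφ-mono-≼ (digitSum-bound ds (Linked.tail h))))
  where
  S = digitSum ds
  P = φ^ (length ds)
  identity-re : ∀ (a b c d : ℤ) → ((c ℤ.+ d) ℤ.- (((+ 1) ℤ.+ ((+ 0) ℤ.+ (a ℤ.+ b))) ℤ.+ ((+ 0) ℤ.- (+ 1))))
                ≡ ((c ℤ.+ d) ℤ.- ((a ℤ.+ ((+ 0) ℤ.- (+ 1))) ℤ.+ (b ℤ.+ (+ 1))))
  identity-re = solve-∀
  identity-im : ∀ (a b c d : ℤ) → ((d ℤ.+ (c ℤ.+ d)) ℤ.- (((+ 0) ℤ.+ (((+ 0) ℤ.+ b) ℤ.+ ((+ 0) ℤ.+ (a ℤ.+ b)))) ℤ.+ (+ 1)))
                ≡ ((d ℤ.+ (c ℤ.+ d)) ℤ.- ((b ℤ.+ (+ 1)) ℤ.+ ((a ℤ.+ ((+ 0) ℤ.- (+ 1))) ℤ.+ (b ℤ.+ (+ 1)))))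
  identity-im = solve-∀

-- The lowest digit is determined by the conjugate (above or below φ⁻¹).
digitSum-injective : ∀ xs ys → length xs ≡ length ys → No11 xs → No11 ys → digitSum xs ≡ digitSum ys → xs ≡ ys
digitSum-injective [] [] _ _ _ _ = refl
digitSum-injective (x ∷ xs) (y ∷ ys) len hx hy eq with x | y
... | true | true = cong (true ∷_) (tails (⊕-cancelˡ 1φ eq))
  where tails : mulφ (digitSum xs) ≡ mulφ (digitSum ys) → xs ≡ ys
        tails e = digitSum-injective xs ys (ℕP.suc-injective len) (Linked.tail hx) (Linked.tail hy) (mulφ-injective e)
... | false | false = cong (false ∷_) (tails (⊕-cancelˡ 0φ eq))
  where tails : mulφ (digitSum xs) ≡ mulφ (digitSum ys) → xs ≡ ys
        tails e = digitSum-injective xs ys (ℕP.suc-injective len) (Linked.tail hx) (Linked.tail hy) (mulφ-injective e)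
... | true | false = ⊥-elim (≺-irrefl (≺-trans (proj₂ (conj-digitSum-false-bounds ys hy))
                              (subst (φ^- 1 ≺_) (cong conj eq) (proj₁ (conj-digitSum-true-bounds xs hx)))))
... | false | true = ⊥-elim (≺-irrefl (≺-trans (proj₂ (conj-digitSum-false-bounds xs hx))
                              (subst (φ^- 1 ≺_) (cong conj (sym eq)) (proj₁ (conj-digitSum-true-bounds ys hy)))))

Zinv-go≡coeff : ∀ ds i → + Zinv-go i ds ≡ coeff (i ℕ.+ 2) (digitSum ds)
Zinv-go≡coeff [] i = sym (coeff-0φ (i ℕ.+ 2))
Zinv-go≡coeff (true ∷ ds) i = begin
  + (fib (i ℕ.+ 2) ℕ.+ Zinv-go (suc i) ds)
    ≡⟨ ℤP.pos-+ (fib (i ℕ.+ 2)) (Zinv-go (suc i) ds) ⟩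
  fibℤ (i ℕ.+ 2) ℤ.+ + Zinv-go (suc i) ds
    ≡⟨ cong₂ ℤ._+_ (sym (coeff-1φ (i ℕ.+ 2))) (trans (Zinv-go≡coeff ds (suc i)) (sym (coeff-mulφ (i ℕ.+ 2) (digitSum ds)))) ⟩
  coeff (i ℕ.+ 2) 1φ ℤ.+ coeff (i ℕ.+ 2) (mulφ (digitSum ds))
    ≡⟨ sym (coeff-⊕ (i ℕ.+ 2) 1φ (mulφ (digitSum ds))) ⟩
  coeff (i ℕ.+ 2) (digitSum (true ∷ ds))
    ∎
  where open ≡-Reasoning
Zinv-go≡coeff (false ∷ ds) i = trans (Zinv-go≡coeff ds (suc i))
  (trans (sym (coeff-mulφ (i ℕ.+ 2) (digitSum ds))) (cong (coeff (i ℕ.+ 2)) (sym (digitSum-false ds))))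

Zinv-go-bound : ∀ ds i → No11 ds → Zinv-go i ds ℕ.+ fib (suc i) ≤ fib (length ds ℕ.+ (i ℕ.+ 2))
Zinv-go-bound [] i _ = ℕP.≤-trans (fib-≤-suc (suc i)) (ℕP.≤-reflexive (cong fib (ℕP.+-comm 2 i)))
Zinv-go-bound (false ∷ ds) i h = ℕP.≤-trans (ℕP.+-monoʳ-≤ (Zinv-go (suc i) ds) (fib-≤-suc (suc i)))
  (ℕP.≤-trans (Zinv-go-bound ds (suc i) (Linked.tail h)) (ℕP.≤-reflexive (cong fib (ℕP.+-suc (length ds) (i ℕ.+ 2)))))
Zinv-go-bound (true ∷ []) i _ = ℕP.≤-reflexive
  (trans (cong (ℕ._+ fib (suc i)) (trans (ℕP.+-identityʳ _) (cong fib (ℕP.+-comm i 2)))) (cong fib (cong suc (ℕP.+-comm 2 i))))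
Zinv-go-bound (true ∷ true ∷ ds) i (() ∷ _)
Zinv-go-bound (true ∷ false ∷ ds) i (_ ∷ h) =
  ℕP.≤-trans (ℕP.≤-reflexive regroup)
    (ℕP.≤-trans (Zinv-go-bound ds (suc (suc i)) (Linked.tail h)) (ℕP.≤-reflexive (cong fib index)))
  where
  Z = Zinv-go (suc (suc i)) ds
  identity : ∀ (a z b : ℕ) → (a ℕ.+ z) ℕ.+ b ≡ z ℕ.+ (a ℕ.+ b)
  identity = ℕSolver.solve-∀
  regroup : (fib (i ℕ.+ 2) ℕ.+ Z) ℕ.+ fib (suc i) ≡ Z ℕ.+ fib (suc (suc (suc i)))
  regroup = trans (cong (λ w → (w ℕ.+ Z) ℕ.+ fib (suc i)) (cong fib (ℕP.+-comm i 2))) (identity (fib (suc (suc i))) Z (fib (suc i)))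
  index : length ds ℕ.+ (suc (suc i) ℕ.+ 2) ≡ suc (suc (length ds)) ℕ.+ (i ℕ.+ 2)
  index = trans (ℕP.+-suc (length ds) (suc i ℕ.+ 2)) (cong suc (ℕP.+-suc (length ds) (i ℕ.+ 2)))

-- Expansions of the integers in Ξ

-- InΞ m N says N ∈ Ξ_{m+1}, i.e. L_{2m+1} < N ≤ L_{2m+3}.
record InΞ (m N : ℕ) : Set where
  constructor inΞ
  field
    Ξ-lower : suc (lucas (suc (double m))) ≤ N
    Ξ-upper : N ≤ lucas (suc (double (suc m)))

InΞ-bracket : ∀ {m N} → InΞ m N → φ^ (suc (double m)) ≺ ι (+ N) × ι (+ N) ≺ φ^ (suc (double (suc m)))
InΞ-bracket {m} {N} (inΞ lo hi) =
  ≺-≼-trans (≺-respˡ (sym (φ^odd≡lucas+φ^- m)) (⊕-monoʳ-≺ (ι (+ L₁)) (φ^-suc≺1 (double m))))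
            (ι-mono-≼ (subst (ℤ._≤ + N) (trans (cong +_ (ℕP.+-comm 1 L₁)) (ℤP.pos-+ L₁ 1)) (+≤+ lo))) ,
  ≼-≺-trans (ι-mono-≼ (+≤+ hi))
            (≺-respˡ (⊕-identityʳ (ι (+ L₂))) (≺-respʳ (sym (φ^odd≡lucas+φ^- (suc m))) (⊕-monoʳ-≺ (ι (+ L₂)) (0≺φ^- (suc (double (suc m)))))))
  where
  L₁ = lucas (suc (double m))
  L₂ = lucas (suc (double (suc m)))

odd-bracket-injective : ∀ {x s t} →
  φ^ (suc (double s)) ≺ x → x ≺ φ^ (suc (double (suc s))) →
  φ^ (suc (double t)) ≺ x → x ≺ φ^ (suc (double (suc t))) → s ≡ t
odd-bracket-injective {x} {s} {t} s-lo s-hi t-lo t-hi with ℕP.<-cmp s t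
... | tri≈ _ s≡t _ = s≡t
... | tri< s<t _ _ = ⊥-elim (≺-irrefl (≺-trans (≺-≼-trans s-hi (φ^≼φ^ (s≤s (double-mono s<t)))) t-lo))
... | tri> _ _ t<s = ⊥-elim (≺-irrefl (≺-trans (≺-≼-trans t-hi (φ^≼φ^ (s≤s (double-mono t<s)))) s-lo))

-- conj (φᴿ N) = N (-φ)⁻ᴿ, so its bounds force R even with φ^{R-1} < N < φ^{R+1}.
lowest-digit-position : ∀ {m N R} → InΞ m N → 1 ≤ R →
  Between (φ^- 1) (conj (scaleφ R (ι (+ N)))) (φ^ 1) → R ≡ double (suc m)
lowest-digit-position {m} {N} {R} N∈Ξ 1≤R (lo , hi) with even-or-odd R
... | t , inj₂ refl = ⊥-elim (≺-irrefl (≺-trans lo' (≺-trans (negφ-antimono-≺ N-pos) (0≺φ^- 1))))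
  where
  N-pos : 0φ ≺ scaleφ⁻¹ (suc (double t)) (ι (+ N))
  N-pos = ≺-respˡ (scaleφ⁻¹-0φ (suc (double t)))
            (scaleφ⁻¹-mono-≺ (suc (double t)) (≺-trans (0≺φ^ (suc (double m))) (proj₁ (InΞ-bracket N∈Ξ))))
  lo' : φ^- 1 ≺ negφ (scaleφ⁻¹ (suc (double t)) (ι (+ N)))
  lo' = ≺-respʳ (trans (conj-scaleφ-odd t (ι (+ N))) (cong (λ z → negφ (scaleφ⁻¹ (suc (double t)) z)) (conj-ι (+ N)))) lo
... | zero , inj₁ refl with 1≤R
...   | ()
lowest-digit-position {m} {N} {R} N∈Ξ 1≤R (lo , hi) | suc t , inj₁ refl =
  cong (λ k → double (suc k)) (odd-bracket-injective N-lo N-hi (proj₁ (InΞ-bracket N∈Ξ)) (proj₂ (InΞ-bracket N∈Ξ)))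
  where
  k = double (suc t)
  conj-eq : conj (scaleφ (double (suc t)) (ι (+ N))) ≡ scaleφ⁻¹ (double (suc t)) (ι (+ N))
  conj-eq = trans (conj-scaleφ-even (suc t) (ι (+ N))) (cong (scaleφ⁻¹ (double (suc t))) (conj-ι (+ N)))
  N-lo : φ^ (suc (double t)) ≺ ι (+ N)
  N-lo = ≺-respˡ (scaleφ-φ^- 1 (suc (double t))) (≺-respʳ (scaleφ-scaleφ⁻¹ k (ι (+ N)))
           (scaleφ-mono-≺ k (≺-respʳ conj-eq lo)))
  N-hi : ι (+ N) ≺ φ^ (suc (double (suc t)))
  N-hi = ≺-respˡ (scaleφ-scaleφ⁻¹ k (ι (+ N))) (≺-respʳ (scaleφ-φ k)
           (scaleφ-mono-≺ k (≺-respˡ conj-eq hi)))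

leadingFalses : List Bool → ℕ
leadingFalses (false ∷ ds) = suc (leadingFalses ds)
leadingFalses _ = zero

dropFalses-split : ∀ ds → ds ≡ replicate (leadingFalses ds) false ++ dropFalses ds
dropFalses-split [] = refl
dropFalses-split (true ∷ ds) = refl
dropFalses-split (false ∷ ds) = cong (false ∷_) (dropFalses-split ds)

dropFalses-view : ∀ ds → dropFalses ds ≡ [] ⊎ ∃ λ ys → dropFalses ds ≡ true ∷ ys
dropFalses-view [] = inj₁ refl
dropFalses-view (true ∷ ds) = inj₂ (ds , refl)
dropFalses-view (false ∷ ds) = dropFalses-view ds

strip-leading-zeros : ∀ x rn ps → scaleφ (length rn) x ≡ digitSum (rn ++ ps) → No11 (rn ++ ps) →
  scaleφ (length (dropFalses rn)) x ≡ digitSum (dropFalses rn ++ ps) × No11 (dropFalses rn ++ ps)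
strip-leading-zeros x rn ps scaled no11 = scaleφ-injective z stripped , No11-++ʳ (replicate z false) (subst No11 split no11)
  where
  z = leadingFalses rn
  u = dropFalses rn
  split : rn ++ ps ≡ replicate z false ++ (u ++ ps)
  split = trans (cong (_++ ps) (dropFalses-split rn)) (ListP.++-assoc (replicate z false) u ps)
  len : length rn ≡ z ℕ.+ length u
  len = trans (cong length (dropFalses-split rn))
              (trans (ListP.length-++ (replicate z false)) (cong (ℕ._+ length u) (ListP.length-replicate z)))
  stripped : scaleφ z (scaleφ (length u) x) ≡ scaleφ z (digitSum (u ++ ps))
  stripped = begin
    scaleφ z (scaleφ (length u) x)          ≡⟨ scaleφ-comm z (length u) x ⟩
    scaleφ (length u) (scaleφ z x)          ≡⟨ sym (scaleφ-+ z (length u) x) ⟩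
    scaleφ (z ℕ.+ length u) x               ≡⟨ cong (λ k → scaleφ k x) (sym len) ⟩
    scaleφ (length rn) x                    ≡⟨ scaled ⟩
    digitSum (rn ++ ps)                     ≡⟨ cong digitSum split ⟩
    digitSum (replicate z false ++ (u ++ ps)) ≡⟨ digitSum-replicate-false z (u ++ ps) ⟩
    scaleφ z (digitSum (u ++ ps))           ∎
    where open ≡-Reasoning

intPart : Expansion → Zφ
intPart e = digitSum (pos e)

fracPart : ℕ → Expansion → Zφ
fracPart N e = ι (+ N) ⊖ intPart e

-- Below the point the digits of N ∈ Ξₙ read (lowest first) 0…0 1 0 rest with |rest| = 2n - 2,
-- so β⁻(N) = reverse (1 0 rest) has length 2n and ends in 01.
record LowDigits (m N : ℕ) (e : Expansion) : Set where
  field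
    rest : List Bool
    βminus≡ : βminus e ≡ reverse (true ∷ false ∷ rest)
    rest-length : length rest ≡ double m
    No11-low : No11 (true ∷ false ∷ rest)
    No11-pos : No11 (pos e)
    digitSum-low : digitSum (true ∷ false ∷ rest) ≡ scaleφ (double (suc m)) (fracPart N e)

  low : Zφ
  low = digitSum (true ∷ false ∷ rest)

ι≢digitSum : ∀ {m N ps} → InΞ m N → No11 ps → ι (+ N) ≢ digitSum ps
ι≢digitSum {m} {N} {ps} N∈Ξ no11 N≡ps = ≺-irrefl (≺-≼-trans φ≺2 (≼-trans 2≤N (≺⇒≼ N≺φ)))
  where
  2≤N : ι (+ 2) ≼ ι (+ N)
  2≤N = ι-mono-≼ (+≤+ (ℕP.≤-trans (s≤s (lucas-suc-pos (double m))) (InΞ.Ξ-lower N∈Ξ)))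
  N≺φ : ι (+ N) ≺ φ^ 1
  N≺φ = ≺-respˡ (trans (cong conj (sym N≡ps)) (conj-ι (+ N))) (proj₂ (conj-digitSum-bounds ps no11))

lowest-block : ∀ {m N ps} zs → InΞ m N → scaleφ (suc (length zs)) (ι (+ N)) ≡ digitSum (true ∷ zs ++ ps) →
               No11 (true ∷ zs ++ ps) → ∃ λ rest → zs ≡ false ∷ rest × length rest ≡ double m
lowest-block {m} {N} {ps} zs N∈Ξ scaled no11 = shape zs position (No11-++ˡ (true ∷ zs) no11)
  where
  position : suc (length zs) ≡ double (suc m)
  position = lowest-digit-position {R = suc (length zs)} N∈Ξ (s≤s z≤n)
    (subst (λ z → Between (φ^- 1) z (φ^ 1)) (cong conj (sym scaled)) (conj-digitSum-true-bounds (zs ++ ps) no11))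
  shape : ∀ ws → suc (length ws) ≡ double (suc m) → No11 (true ∷ ws) → ∃ λ rest → ws ≡ false ∷ rest × length rest ≡ double m
  shape [] () _
  shape (true ∷ _) _ (() ∷ _)
  shape (false ∷ rest) len _ = rest , refl , ℕP.suc-injective (ℕP.suc-injective len)

lowDigits : ∀ {m N e} → InΞ m N → IsBasePhiExpansion N e → LowDigits m N e
lowDigits {m} {N} {e} N∈Ξ (value≡N , no11) = from-view (dropFalses-view rn)
  where
  rn = reverse (neg e)
  ps = pos e
  scaled : scaleφ (length rn) (ι (+ N)) ≡ digitSum (rn ++ ps)
  scaled = trans (cong (λ k → scaleφ k (ι (+ N))) (ListP.length-reverse (neg e)))
                 (trans (cong (scaleφ (length (neg e))) (sym value≡N)) (scaleφ-value e))
  stripped : ∀ {u} → dropFalses rn ≡ u → scaleφ (length u) (ι (+ N)) ≡ digitSum (u ++ ps) × No11 (u ++ ps)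
  stripped refl = strip-leading-zeros (ι (+ N)) rn ps scaled no11
  from-block : ∀ {zs} → (∃ λ rest → zs ≡ false ∷ rest × length rest ≡ double m) → dropFalses rn ≡ true ∷ zs → LowDigits m N e
  from-block (rest , refl , len) lowest = record
    { rest = rest
    ; βminus≡ = cong reverse lowest
    ; rest-length = len
    ; No11-low = No11-++ˡ (true ∷ false ∷ rest) (proj₂ (stripped lowest))
    ; No11-pos = No11-++ʳ (true ∷ false ∷ rest) (proj₂ (stripped lowest))
    ; digitSum-low = subst (λ k → digitSum (true ∷ false ∷ rest) ≡ scaleφ k (fracPart N e)) (cong (λ k → suc (suc k)) len)
                       (digitSum-prefix (true ∷ false ∷ rest) ps (ι (+ N)) (proj₁ (stripped lowest)))
    }
  from-view : dropFalses rn ≡ [] ⊎ ∃ (λ zs → dropFalses rn ≡ true ∷ zs) → LowDigits m N e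
  from-view (inj₁ none) = ⊥-elim (ι≢digitSum N∈Ξ (proj₂ (stripped none)) (proj₁ (stripped none)))
  from-view (inj₂ (zs , lowest)) =
    from-block (lowest-block zs N∈Ξ (proj₁ (stripped lowest)) (proj₂ (stripped lowest))) lowest

dropLast2-reverse-10 : ∀ rest → dropLast2 (reverse (true ∷ false ∷ rest)) ≡ reverse rest
dropLast2-reverse-10 rest = begin
  dropLast2 (reverse (true ∷ false ∷ rest))
    ≡⟨ cong dropLast2 (ListP.reverse-++ (true ∷ false ∷ []) rest) ⟩
  take (length (reverse rest ++ false ∷ true ∷ []) ∸ 2) (reverse rest ++ false ∷ true ∷ [])
    ≡⟨ cong (λ k → take (k ∸ 2) (reverse rest ++ false ∷ true ∷ [])) (ListP.length-++ (reverse rest)) ⟩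
  take (length (reverse rest) ℕ.+ 2 ∸ 2) (reverse rest ++ false ∷ true ∷ [])
    ≡⟨ cong (λ k → take k (reverse rest ++ false ∷ true ∷ [])) (ℕP.m+n∸n≡m (length (reverse rest)) 2) ⟩
  take (length (reverse rest)) (reverse rest ++ false ∷ true ∷ [])
    ≡⟨ take-length-++ (reverse rest) ⟩
  reverse rest
    ∎
  where
  open ≡-Reasoning
  take-length-++ : ∀ {A : Set} (xs : List A) {ys} → take (length xs) (xs ++ ys) ≡ xs
  take-length-++ [] = refl
  take-length-++ (x ∷ xs) = cong (x ∷_) (take-length-++ xs)

label : Expansion → ℕ
label e = Zinv (dropLast2 (βminus e))

module _ {m N e} (D : LowDigits m N e) where
  open LowDigits D

  label≡Zinv-go : label e ≡ Zinv-go 0 rest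
  label≡Zinv-go = begin
    Zinv (dropLast2 (βminus e))                   ≡⟨ cong (λ w → Zinv (dropLast2 w)) βminus≡ ⟩
    Zinv (dropLast2 (reverse (true ∷ false ∷ rest))) ≡⟨ cong Zinv (dropLast2-reverse-10 rest) ⟩
    Zinv-go 0 (reverse (reverse rest))            ≡⟨ cong (Zinv-go 0) (ListP.reverse-involutive rest) ⟩
    Zinv-go 0 rest                                ∎
    where open ≡-Reasoning

  label≡im-low : + label e ≡ im low
  label≡im-low = trans (cong +_ label≡Zinv-go) (trans (Zinv-go≡coeff rest 0) (sym (identity (re S) (im S))))
    where
    S = digitSum rest
    identity : ∀ (a b : ℤ) → + 0 ℤ.+ ((+ 0 ℤ.+ b) ℤ.+ (+ 0 ℤ.+ (a ℤ.+ b))) ≡ a ℤ.* + 1 ℤ.+ b ℤ.* + 2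
    identity = solve-∀

  label<fib : label e ℕ.< fib (double (suc m))
  label<fib = subst (ℕ._< fib (double (suc m))) (sym label≡Zinv-go)
    (ℕP.≤-trans (ℕP.≤-reflexive (ℕP.+-comm 1 (Zinv-go 0 rest)))
    (ℕP.≤-trans (Zinv-go-bound rest 0 (Linked.tail (Linked.tail No11-low)))
                (ℕP.≤-reflexive (cong fib (trans (cong (ℕ._+ 2) rest-length) (ℕP.+-comm (double m) 2))))))

  fracPart≡ : fracPart N e ≡ scaleφ⁻¹ (double (suc m)) low
  fracPart≡ = trans (sym (scaleφ⁻¹-scaleφ (double (suc m)) _)) (cong (scaleφ⁻¹ (double (suc m))) (sym digitSum-low))

  fracPart-nonneg : 0φ ≼ fracPart N e
  fracPart-nonneg = ≼-respˡ (scaleφ⁻¹-0φ (double (suc m))) (≼-respʳ (sym fracPart≡)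
    (scaleφ⁻¹-mono-≼ (double (suc m)) (digitSum-nonneg (true ∷ false ∷ rest))))

  fracPart-≺1 : fracPart N e ≺ 1φ
  fracPart-≺1 = ≺-respˡ (sym fracPart≡) (≺-respʳ 1φ≡ (scaleφ⁻¹-mono-≺ (double (suc m)) low≺φ^2n))
    where
    low≺φ^2n : low ≺ φ^ (double (suc m))
    low≺φ^2n = ≺-≼-trans (≺-respˡ (⊕-identityʳ low) (⊕-monoʳ-≺ low (0≺φ^- 1)))
      (≼-respʳ (cong (λ k → φ^ (suc (suc k))) rest-length) (digitSum-bound (true ∷ false ∷ rest) No11-low))
    1φ≡ : scaleφ⁻¹ (double (suc m)) (φ^ (double (suc m))) ≡ 1φ
    1φ≡ = trans (cong (scaleφ⁻¹ (double (suc m))) (φ^≡scaleφ (double (suc m)))) (scaleφ⁻¹-scaleφ (double (suc m)) 1φ)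

  conj-intPart-bounds : Between (negφ 1φ) (conj (intPart e)) (φ^ 1)
  conj-intPart-bounds = conj-digitSum-bounds (pos e) No11-pos

  conj-low-bounds : Between (φ^- 1) (conj low) (φ^ 1)
  conj-low-bounds = conj-digitSum-true-bounds (false ∷ rest) No11-low

  conj-low≡ : conj low ≡ scaleφ⁻¹ (double (suc m)) (conj (fracPart N e))
  conj-low≡ = trans (cong conj digitSum-low) (conj-scaleφ-even (suc m) (fracPart N e))

module _ {m N e N' e'} (D : LowDigits m N e) (D' : LowDigits m N' e') where
  private
    x = intPart e
    x' = intPart e'
    v = fracPart N e
    v' = fracPart N' e'

  -- x + v = N and x' + v' = N + 1 with v, v' ∈ [0, 1), so x' - x ∈ (0, 2).
  im-intPart-mono : N' ≡ suc N → im x ℤ.≤ im x'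
  im-intPart-mono refl = 0≤j-i⇒i≤j (im-nonneg (re x' ℤ.- re x) (im x' ℤ.- im x) 0≺x'-x conj≺)
    where
    identity-re : ∀ (p p' n : ℤ) → (p' ℤ.- p) ℤ.- + 0 ≡ (+ 1 ℤ.- + 0) ℤ.- (((+ 1 ℤ.+ n) ℤ.- p') ℤ.- (n ℤ.- p))
    identity-re = solve-∀
    identity-im : ∀ (q q' : ℤ) → (q' ℤ.- q) ℤ.- + 0 ≡ (+ 0 ℤ.- + 0) ℤ.- ((+ 0 ℤ.- q') ℤ.- (+ 0 ℤ.- q))
    identity-im = solve-∀
    0≺x'-x : 0φ ≺ x' ⊖ x
    0≺x'-x = ≺-by-difference {a = v' ⊖ v} {b = 1φ ⊖ 0φ}
      (Zφ-≡ (identity-re (re x) (re x') (+ N)) (identity-im (im x) (im x')))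
      (⊖-mono-≺-≼ (fracPart-≺1 D') (fracPart-nonneg D))
    conj≺ : conj (x' ⊖ x) ≺ + 1 +φ* + 1
    conj≺ = ≺-respˡ (sym (conj-⊖ x' x)) (⊖-mono-≺ (proj₂ (conj-intPart-bounds D')) (proj₁ (conj-intPart-bounds D)))

  im-intPart-step : N' ≡ suc N → im x' ℤ.≤ im x ℤ.+ + 1
  im-intPart-step refl = subst (ℤ._≤ im x ℤ.+ + 1) (identity (im x) (im x'))
    (ℤP.+-monoʳ-≤ (im x) (im-≤1 (re x' ℤ.- re x) (im x' ℤ.- im x) x'-x≺2 ≺conj))
    where
    identity : ∀ (a b : ℤ) → a ℤ.+ (b ℤ.- a) ≡ b
    identity = solve-∀
    identity-re : ∀ (p p' n : ℤ) → + 2 ℤ.- (p' ℤ.- p) ≡ (+ 1 ℤ.- + 0) ℤ.- ((n ℤ.- p) ℤ.- ((+ 1 ℤ.+ n) ℤ.- p'))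
    identity-re = solve-∀
    identity-im : ∀ (q q' : ℤ) → + 0 ℤ.- (q' ℤ.- q) ≡ (+ 0 ℤ.- + 0) ℤ.- ((+ 0 ℤ.- q) ℤ.- (+ 0 ℤ.- q'))
    identity-im = solve-∀
    x'-x≺2 : x' ⊖ x ≺ ι (+ 2)
    x'-x≺2 = ≺-by-difference {a = v ⊖ v'} {b = 1φ ⊖ 0φ}
      (Zφ-≡ (identity-re (re x) (re x') (+ N)) (identity-im (im x) (im x')))
      (⊖-mono-≺-≼ (fracPart-≺1 D) (fracPart-nonneg D'))
    ≺conj : negφ (+ 1 +φ* + 1) ≺ conj (x' ⊖ x)
    ≺conj = ≺-respʳ (sym (conj-⊖ x' x)) (⊖-mono-≺ (proj₁ (conj-intPart-bounds D')) (proj₂ (conj-intPart-bounds D)))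

  βminus≡⇒im≡ : βminus e ≡ βminus e' → im x ≡ im x'
  βminus≡⇒im≡ βminus-eq = trans (sym (identity (im x))) (trans (cong (λ z → + 0 ℤ.- z) (cong im v≡v')) (identity (im x')))
    where
    identity : ∀ (q : ℤ) → + 0 ℤ.- (+ 0 ℤ.- q) ≡ q
    identity = solve-∀
    v≡v' : v ≡ v'
    v≡v' = trans (fracPart≡ D) (trans (cong (λ r → scaleφ⁻¹ (double (suc m)) (digitSum (true ∷ false ∷ r))) rest≡) (sym (fracPart≡ D')))
      where
      rest≡ : LowDigits.rest D ≡ LowDigits.rest D'
      rest≡ = ListP.∷-injectiveʳ (ListP.∷-injectiveʳ
        (ListP.reverse-injective (trans (sym (LowDigits.βminus≡ D)) (trans βminus-eq (LowDigits.βminus≡ D')))))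

  -- Equal integer parts (by the φ-coefficient) leave fractional parts differing by an integer in (-1, 1).
  im≡⇒βminus≡ : im x ≡ im x' → βminus e ≡ βminus e'
  im≡⇒βminus≡ im-eq = trans (LowDigits.βminus≡ D) (trans (cong reverse low-digits≡) (sym (LowDigits.βminus≡ D')))
    where
    d = re v ℤ.- re v'
    im-diff : im v ℤ.- im v' ≡ + 0
    im-diff = trans (cong (λ z → (+ 0 ℤ.- im x) ℤ.- (+ 0 ℤ.- z)) (sym im-eq)) (identity (im x))
      where identity : ∀ (q : ℤ) → (+ 0 ℤ.- q) ℤ.- (+ 0 ℤ.- q) ≡ + 0
            identity = solve-∀
    v-v'≡d : v ⊖ v' ≡ ι d
    v-v'≡d = Zφ-≡ refl im-diff
    d<1 : d ℤ.< + 1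
    d<1 = ι-cancel-≺ (≺-respˡ v-v'≡d (⊖-mono-≺-≼ (fracPart-≺1 D) (fracPart-nonneg D')))
    -1<d : ℤ.- (+ 1) ℤ.< d
    -1<d = ι-cancel-≺ (≺-respʳ v-v'≡d (⊖-mono-≼-≺ (fracPart-nonneg D) (fracPart-≺1 D')))
    v≡v' : v ≡ v'
    v≡v' = ⊖≡0φ⇒≡ (trans v-v'≡d (cong ι (-1<i<1⇒i≡0 -1<d d<1)))
    low-digits≡ : true ∷ false ∷ LowDigits.rest D ≡ true ∷ false ∷ LowDigits.rest D'
    low-digits≡ = digitSum-injective _ _
      (cong (λ k → suc (suc k)) (trans (LowDigits.rest-length D) (sym (LowDigits.rest-length D'))))
      (LowDigits.No11-low D) (LowDigits.No11-low D')
      (trans (LowDigits.digitSum-low D) (trans (cong (scaleφ (double (suc m))) v≡v') (sym (LowDigits.digitSum-low D'))))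

  -- One more unit in the φ-coefficient makes v' - v = d - φ with d ≥ 1, whose conjugate d - 1 + φ is positive.
  conj-low-increasing : im x' ≡ im x ℤ.+ + 1 → conj (LowDigits.low D) ≺ conj (LowDigits.low D')
  conj-low-increasing im-eq =
    ≺-by-difference {a = 0φ} {b = scaleφ⁻¹ (double (suc m)) (conj v' ⊖ conj v)} difference
      (≺-respˡ (scaleφ⁻¹-0φ (double (suc m))) (scaleφ⁻¹-mono-≺ (double (suc m)) conj-pos'))
    where
    d = re v' ℤ.- re v
    im-diff : im v' ℤ.- im v ≡ ℤ.- (+ 1)
    im-diff = trans (cong (λ z → (+ 0 ℤ.- z) ℤ.- (+ 0 ℤ.- im x)) im-eq) (identity (im x))
      where identity : ∀ (q : ℤ) → (+ 0 ℤ.- (q ℤ.+ + 1)) ℤ.- (+ 0 ℤ.- q) ≡ ℤ.- (+ 1)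
            identity = solve-∀
    v'-v≡ : v' ⊖ v ≡ d +φ* ℤ.- (+ 1)
    v'-v≡ = Zφ-≡ refl im-diff
    1≤d : + 1 ℤ.≤ d
    1≤d = re-≥1 d (≺-respʳ v'-v≡ (⊖-mono-≼-≺ (fracPart-nonneg D') (fracPart-≺1 D)))
    conj-pos' : 0φ ≺ conj v' ⊖ conj v
    conj-pos' = ≺-respʳ (trans (cong conj (sym v'-v≡)) (conj-⊖ v' v)) (conj-pos d 1≤d)
    difference : conj (LowDigits.low D') ⊖ conj (LowDigits.low D) ≡ scaleφ⁻¹ (double (suc m)) (conj v' ⊖ conj v) ⊖ 0φ
    difference = begin
      conj (LowDigits.low D') ⊖ conj (LowDigits.low D)
        ≡⟨ cong₂ _⊖_ (conj-low≡ D') (conj-low≡ D) ⟩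
      scaleφ⁻¹ (double (suc m)) (conj v') ⊖ scaleφ⁻¹ (double (suc m)) (conj v)
        ≡⟨ sym (scaleφ⁻¹-⊖ (double (suc m)) (conj v') (conj v)) ⟩
      scaleφ⁻¹ (double (suc m)) (conj v' ⊖ conj v)
        ≡⟨ sym (⊖-identityʳ _) ⟩
      scaleφ⁻¹ (double (suc m)) (conj v' ⊖ conj v) ⊖ 0φ
        ∎
      where open ≡-Reasoning

√5*-nonneg : ∀ d → + 0 ℤ.≤ d → 0φ ≼ √5* d
√5*-nonneg d 0≤d = mk≼ (0 , λ j _ → subst₂ ℤ._≤_ (sym (coeff-0φ j)) (sym (identity d (fibℤ j) (fibℤ (suc j))))
  (ℤP.+-mono-≤ (0≤-* 0≤d (+≤+ z≤n)) (0≤-* 0≤d (ℤP.i≤j⇒0≤j-i (+≤+ (fib-≤-suc j))))))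
  where identity : ∀ (d f g : ℤ) → (ℤ.- d) ℤ.* f ℤ.+ (d ℤ.+ d) ℤ.* g ≡ d ℤ.* g ℤ.+ d ℤ.* (g ℤ.- f)
        identity = solve-∀

√5*-mono-≼ : ∀ {a b} → a ℤ.≤ b → √5* a ≼ √5* b
√5*-mono-≼ {a} {b} a≤b = ≼-by-difference {a = 0φ} {b = √5* (b ℤ.- a)} (Zφ-≡ (identity₁ a b) (identity₂ a b))
                           (√5*-nonneg (b ℤ.- a) (ℤP.i≤j⇒0≤j-i a≤b))
  where
  identity₁ : ∀ (a b : ℤ) → ℤ.- b ℤ.- ℤ.- a ≡ ℤ.- (b ℤ.- a) ℤ.- + 0
  identity₁ = solve-∀
  identity₂ : ∀ (a b : ℤ) → (b ℤ.+ b) ℤ.- (a ℤ.+ a) ≡ ((b ℤ.- a) ℤ.+ (b ℤ.- a)) ℤ.- + 0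
  identity₂ = solve-∀

-- Integer bounds from real bounds on b√5, using Fₖ√5 = φᵏ + φ⁻ᵏ and Lₖ = φᵏ - φ⁻ᵏ for odd k.
fib≤-of-√5* : ∀ t B → φ^ (suc (double t)) ⊖ 1φ ≺ √5* B → fibℤ (suc (double t)) ℤ.≤ B
fib≤-of-√5* t B lower with fibℤ (suc (double t)) ℤ.≤? B
... | yes F≤B = F≤B
... | no F≰B = ⊥-elim (≺-irrefl (≺-trans (≺-≼-trans (⊕-mono-≺-≼ lower (≼-refl {√5* (+ 1)})) (≼-trans too-small
                        (⊕-mono-≼ (≼-refl {φ^ k}) (φ^-suc≼φ^-1 (double t))))) slack))
  where
  k = suc (double t)
  identity-re : ∀ (c : ℤ) → ((c ℤ.- (+ 1)) ℤ.+ (ℤ.- (+ 1))) ℤ.- (c ℤ.+ ((+ 0) ℤ.- (+ 1))) ≡ ((+ 0) ℤ.- (+ 1)) ℤ.- (+ 0)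
  identity-re = solve-∀
  identity-im : ∀ (d : ℤ) → ((d ℤ.- (+ 0)) ℤ.+ ((+ 1) ℤ.+ (+ 1))) ℤ.- (d ℤ.+ (+ 1)) ≡ (+ 1) ℤ.- (+ 0)
  identity-im = solve-∀
  too-small : √5* B ⊕ √5* (+ 1) ≼ φ^ k ⊕ φ^- k
  too-small = ≼-respˡ (√5*-⊕ B (+ 1)) (≼-respʳ (√5*fib-odd t)
    (√5*-mono-≼ (ℤP.≤-trans (ℤP.≤-reflexive (ℤP.+-comm B (+ 1))) (ℤP.i<j⇒suc[i]≤j (ℤP.≰⇒> F≰B)))))
  slack : φ^ k ⊕ φ^- 1 ≺ (φ^ k ⊖ 1φ) ⊕ √5* (+ 1)
  slack = ≺-by-difference {a = 0φ} {b = φ^- 1} (Zφ-≡ (identity-re (re (φ^ k))) (identity-im (im (φ^ k)))) (0≺φ^- 1)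

<fib-of-√5* : ∀ t B → √5* B ≺ φ^ (suc (double t)) → B ℤ.< fibℤ (suc (double t))
<fib-of-√5* t B upper with B ℤ.<? fibℤ (suc (double t))
... | yes B<F = B<F
... | no B≮F = ⊥-elim (≺-irrefl (≺-≼-trans (≼-≺-trans too-big upper) (≼-by-difference {a = 0φ} {b = φ^- k}
                   (Zφ-≡ (identity (re (φ^ k)) (re (φ^- k))) (identity (im (φ^ k)) (im (φ^- k)))) (≺⇒≼ (0≺φ^- k)))))
  where
  k = suc (double t)
  identity : ∀ (c r : ℤ) → (c ℤ.+ r) ℤ.- c ≡ r ℤ.- (+ 0)
  identity = solve-∀
  too-big : φ^ k ⊕ φ^- k ≼ √5* B
  too-big = ≼-respˡ (√5*fib-odd t) (√5*-mono-≼ (ℤP.≮⇒≥ B≮F))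

√5*fib-odd≡ : ∀ t → √5* (fibℤ (suc (double t))) ≡ (ι (+ lucas (suc (double t))) ⊕ φ^- (suc (double t))) ⊕ φ^- (suc (double t))
√5*fib-odd≡ t = trans (√5*fib-odd t) (cong (_⊕ φ^- (suc (double t))) (φ^odd≡lucas+φ^- t))

≤fib-of-√5* : ∀ t B → √5* B ≺ ι (+ suc (lucas (suc (double t)))) ⊖ negφ 1φ → B ℤ.≤ fibℤ (suc (double t))
≤fib-of-√5* t B upper with B ℤ.≤? fibℤ (suc (double t))
... | yes B≤F = B≤F
... | no B≰F = ⊥-elim (≺-irrefl (≺-≼-trans (≼-≺-trans too-big upper) slack))
  where
  L = lucas (suc (double t))
  ψ = φ^- (suc (double t))
  too-big : √5* (+ 1) ⊕ ((ι (+ L) ⊕ ψ) ⊕ ψ) ≼ √5* B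
  too-big = ≼-respˡ (trans (√5*-⊕ (+ 1) (fibℤ (suc (double t)))) (cong (√5* (+ 1) ⊕_) (√5*fib-odd≡ t)))
              (√5*-mono-≼ (ℤP.i<j⇒suc[i]≤j (ℤP.≰⇒> B≰F)))
  identity-re : ∀ (l r : ℤ) → ((ℤ.- (+ 1)) ℤ.+ ((l ℤ.+ r) ℤ.+ r)) ℤ.- ((+ 1 ℤ.+ l) ℤ.- (ℤ.- (+ 1)))
                ≡ ((r ℤ.+ r) ℤ.+ (((+ 0) ℤ.- (+ 1)) ℤ.- ((+ 1) ℤ.- ((+ 0) ℤ.- (+ 1))))) ℤ.- (+ 0)
  identity-re = solve-∀
  identity-im : ∀ (s : ℤ) → (((+ 1) ℤ.+ (+ 1)) ℤ.+ (((+ 0) ℤ.+ s) ℤ.+ s)) ℤ.- ((+ 0) ℤ.- (ℤ.- (+ 0)))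
                ≡ ((s ℤ.+ s) ℤ.+ ((+ 1) ℤ.- ((+ 0) ℤ.- (+ 1)))) ℤ.- (+ 0)
  identity-im = solve-∀
  slack : ι (+ suc L) ⊖ negφ 1φ ≼ √5* (+ 1) ⊕ ((ι (+ L) ⊕ ψ) ⊕ ψ)
  slack = ≼-by-difference {a = 0φ} {b = (ψ ⊕ ψ) ⊕ φ^- 3} (Zφ-≡ (identity-re (+ L) (re ψ)) (identity-im (im ψ)))
    (⊕-mono-≼ {x = 0φ} (≼-respˡ (⊕-identityˡ 0φ) (⊕-mono-≼ (≺⇒≼ (0≺φ^- (suc (double t)))) (≺⇒≼ (0≺φ^- (suc (double t)))))) (≺⇒≼ (0≺φ^- 3)))

fib≤suc-of-√5* : ∀ t B → (ι (+ lucas (suc (double t))) ⊖ 1φ) ⊖ φ^ 1 ≺ √5* B → fibℤ (suc (double t)) ℤ.≤ B ℤ.+ + 1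
fib≤suc-of-√5* t B lower with fibℤ (suc (double t)) ℤ.≤? B ℤ.+ + 1
... | yes F≤B+1 = F≤B+1
... | no F≰B+1 = ⊥-elim (≺-irrefl (≺-trans (≺-≼-trans (⊕-mono-≺-≼ lower (≼-refl {√5* (+ 2)})) (≼-trans too-small ψ≼φ⁻¹)) slack))
  where
  L = lucas (suc (double t))
  ψ = φ^- (suc (double t))
  identity-re₁ : ∀ (b : ℤ) → ℤ.- (+ 1 ℤ.+ (b ℤ.+ + 1)) ≡ ℤ.- b ℤ.+ ℤ.- (+ 2)
  identity-re₁ = solve-∀
  identity-im₁ : ∀ (b : ℤ) → (+ 1 ℤ.+ (b ℤ.+ + 1)) ℤ.+ (+ 1 ℤ.+ (b ℤ.+ + 1)) ≡ (b ℤ.+ b) ℤ.+ (+ 2 ℤ.+ + 2)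
  identity-im₁ = solve-∀
  too-small : √5* B ⊕ √5* (+ 2) ≼ (ι (+ L) ⊕ ψ) ⊕ ψ
  too-small = ≼-respˡ (Zφ-≡ (identity-re₁ B) (identity-im₁ B)) (≼-respʳ (√5*fib-odd≡ t)
                (√5*-mono-≼ (ℤP.i<j⇒suc[i]≤j (ℤP.≰⇒> F≰B+1))))
  ψ≼φ⁻¹ : (ι (+ L) ⊕ ψ) ⊕ ψ ≼ (ι (+ L) ⊕ φ^- 1) ⊕ φ^- 1
  ψ≼φ⁻¹ = ⊕-mono-≼ (⊕-mono-≼ (≼-refl {ι (+ L)}) (φ^-suc≼φ^-1 (double t))) (φ^-suc≼φ^-1 (double t))
  identity-re₂ : ∀ (l : ℤ) → (((l ℤ.- (+ 1)) ℤ.- (+ 0)) ℤ.+ (ℤ.- (+ 2))) ℤ.- ((l ℤ.+ ((+ 0) ℤ.- (+ 1))) ℤ.+ ((+ 0) ℤ.- (+ 1)))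
                 ≡ ((+ 0) ℤ.- (+ 1)) ℤ.- (+ 0)
  identity-re₂ = solve-∀
  identity-im₂ : ((((+ 0) ℤ.- (+ 0)) ℤ.- ((+ 1) ℤ.+ (+ 0))) ℤ.+ ((+ 2) ℤ.+ (+ 2))) ℤ.- (((+ 0) ℤ.+ (+ 1)) ℤ.+ (+ 1))
                 ≡ (+ 1) ℤ.- (+ 0)
  identity-im₂ = refl
  slack : (ι (+ L) ⊕ φ^- 1) ⊕ φ^- 1 ≺ ((ι (+ L) ⊖ 1φ) ⊖ φ^ 1) ⊕ √5* (+ 2)
  slack = ≺-by-difference {a = 0φ} {b = φ^- 1} (Zφ-≡ (identity-re₂ (+ L)) identity-im₂) (0≺φ^- 1)

module _ {m N e} (D : LowDigits m N e) where
  private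
    x = intPart e
    v = fracPart N e

  √5*im≡conj-difference : √5* (im x) ≡ conj v ⊖ v
  √5*im≡conj-difference = Zφ-≡ (identity-re (re x) (im x) (+ N)) (identity-im (im x))
    where
    identity-re : ∀ (p q n : ℤ) → ℤ.- q ≡ ((n ℤ.- p) ℤ.+ ((+ 0) ℤ.- q)) ℤ.- (n ℤ.- p)
    identity-re = solve-∀
    identity-im : ∀ (q : ℤ) → q ℤ.+ q ≡ (ℤ.- ((+ 0) ℤ.- q)) ℤ.- ((+ 0) ℤ.- q)
    identity-im = solve-∀

  √5*im≡difference : √5* (im x) ≡ x ⊖ conj x
  √5*im≡difference = Zφ-≡ (identity-re (re x) (im x)) (identity-im (im x))
    where
    identity-re : ∀ (p q : ℤ) → ℤ.- q ≡ p ℤ.- (p ℤ.+ q)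
    identity-re = solve-∀
    identity-im : ∀ (q : ℤ) → q ℤ.+ q ≡ q ℤ.- (ℤ.- q)
    identity-im = solve-∀

  private
    conj-v≡ : conj v ≡ scaleφ (double (suc m)) (conj (LowDigits.low D))
    conj-v≡ = trans (sym (scaleφ-scaleφ⁻¹ (double (suc m)) (conj v))) (cong (scaleφ (double (suc m))) (sym (conj-low≡ D)))

  im-intPart-lower : fibℤ (suc (double m)) ℤ.≤ im x
  im-intPart-lower = fib≤-of-√5* m (im x) (≺-respʳ (sym √5*im≡conj-difference) (⊖-mono-≺ conj-v-lower (fracPart-≺1 D)))
    where
    conj-v-lower : φ^ (suc (double m)) ≺ conj v
    conj-v-lower = ≺-respˡ (scaleφ-φ^- 1 (suc (double m))) (≺-respʳ (sym conj-v≡)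
                     (scaleφ-mono-≺ (double (suc m)) (proj₁ (conj-low-bounds D))))

  im-intPart-upper : im x ℤ.< fibℤ (suc (double (suc m)))
  im-intPart-upper = <fib-of-√5* (suc m) (im x) (≺-respˡ (sym √5*im≡conj-difference)
    (≺-respʳ (⊖-identityʳ _) (⊖-mono-≺-≼ conj-v-upper (fracPart-nonneg D))))
    where
    conj-v-upper : conj v ≺ φ^ (suc (double (suc m)))
    conj-v-upper = ≺-respˡ (sym conj-v≡) (≺-respʳ (scaleφ-φ (double (suc m)))
                     (scaleφ-mono-≺ (double (suc m)) (proj₂ (conj-low-bounds D))))

  im-intPart-first : N ≡ suc (lucas (suc (double m))) → im x ℤ.≤ fibℤ (suc (double m))
  im-intPart-first refl = ≤fib-of-√5* m (im x) (≺-respˡ (sym √5*im≡difference)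
    (⊖-mono-≼-≺ x≼N (proj₁ (conj-intPart-bounds D))))
    where
    identity-re : ∀ (p n : ℤ) → n ℤ.- p ≡ (n ℤ.- p) ℤ.- (+ 0)
    identity-re = solve-∀
    identity-im : ∀ (q : ℤ) → (+ 0) ℤ.- q ≡ ((+ 0) ℤ.- q) ℤ.- (+ 0)
    identity-im = solve-∀
    x≼N : x ≼ ι (+ N)
    x≼N = ≼-by-difference {a = 0φ} {b = v} (Zφ-≡ (identity-re (re x) (+ N)) (identity-im (im x))) (fracPart-nonneg D)

  im-intPart-last : N ≡ lucas (suc (double (suc m))) → fibℤ (suc (double (suc m))) ℤ.≤ im x ℤ.+ + 1
  im-intPart-last refl = fib≤suc-of-√5* (suc m) (im x) (≺-respʳ (sym √5*im≡difference)
    (⊖-mono-≺ N-1≺x (proj₂ (conj-intPart-bounds D))))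
    where
    identity-re : ∀ (p n : ℤ) → p ℤ.- (n ℤ.- (+ 1)) ≡ (+ 1) ℤ.- (n ℤ.- p)
    identity-re = solve-∀
    identity-im : ∀ (q : ℤ) → q ℤ.- ((+ 0) ℤ.- (+ 0)) ≡ (+ 0) ℤ.- ((+ 0) ℤ.- q)
    identity-im = solve-∀
    N-1≺x : ι (+ N) ⊖ 1φ ≺ x
    N-1≺x = ≺-by-difference {a = v} {b = 1φ} (Zφ-≡ (identity-re (re x) (+ N)) (identity-im (im x))) (fracPart-≺1 D)

-- Fractional parts of -kφ

IsFloor≺ : Zφ → ℤ → Set
IsFloor≺ x m = ι m ≼ x × x ≺ ι (m ℤ.+ + 1)

FracLt≺ : ℕ → ℕ → Set
FracLt≺ k k' = ∃₂ λ m m' → IsFloor≺ (negKφ k) m × IsFloor≺ (negKφ k') m' × (negKφ k ⊖ ι m ≺ negKφ k' ⊖ ι m')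

IsFloor⇒IsFloor≺ : ∀ {x m} → IsFloor x m → IsFloor≺ x m
IsFloor⇒IsFloor≺ (lower , upper) = ≤φ⇒≼ lower , <φ⇒≺ upper

FracLt⇒FracLt≺ : ∀ {k k'} → FracLt k k' → FracLt≺ k k'
FracLt⇒FracLt≺ (m , m' , floor , floor' , lt) = m , m' , IsFloor⇒IsFloor≺ floor , IsFloor⇒IsFloor≺ floor' , <φ⇒≺ lt

IsFloor≺-unique : ∀ {x m m'} → IsFloor≺ x m → IsFloor≺ x m' → m ≡ m'
IsFloor≺-unique {x} {m} {m'} (m≤x , x<m+1) (m'≤x , x<m'+1) with ℤP.<-cmp m m'
... | tri≈ _ m≡m' _ = m≡m'
... | tri< m<m' _ _ = ⊥-elim (≺⇒⋡ x<m+1 (≼-trans (ι-mono-≼ (suc≤ m<m')) m'≤x))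
  where suc≤ : ∀ {i j} → i ℤ.< j → i ℤ.+ + 1 ℤ.≤ j
        suc≤ {i} i<j = subst (ℤ._≤ _) (ℤP.+-comm (+ 1) i) (ℤP.i<j⇒suc[i]≤j i<j)
... | tri> _ _ m'<m = ⊥-elim (≺⇒⋡ x<m'+1 (≼-trans (ι-mono-≼ (suc≤ m'<m)) m≤x))
  where suc≤ : ∀ {i j} → i ℤ.< j → i ℤ.+ + 1 ℤ.≤ j
        suc≤ {i} i<j = subst (ℤ._≤ _) (ℤP.+-comm (+ 1) i) (ℤP.i<j⇒suc[i]≤j i<j)

FracLt≺-trans : ∀ {a b c} → FracLt≺ a b → FracLt≺ b c → FracLt≺ a c
FracLt≺-trans (m₁ , m₂ , floor₁ , floor₂ , lt₁) (m₂' , m₃ , floor₂' , floor₃ , lt₂) with IsFloor≺-unique floor₂ floor₂'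
... | refl = m₁ , m₃ , floor₁ , floor₃ , ≺-trans lt₁ lt₂

FracLt≺-irrefl : ∀ {a} → ¬ FracLt≺ a a
FracLt≺-irrefl (m₁ , m₂ , floor₁ , floor₂ , lt) with IsFloor≺-unique floor₁ floor₂
... | refl = ≺-irrefl lt

-- For k = c + 1 with c the label of N, {-kφ} = conj (low digits) - φ⁻¹ ∈ (0, 1).
module _ {m N e} (D : LowDigits m N e) where
  private
    Y = LowDigits.low D
    c = + label e
    Y≡ : Y ≡ re Y +φ* c
    Y≡ = Zφ-≡ refl (sym (label≡im-low D))

  floor-of-point : ℤ
  floor-of-point = ℤ.- (re Y ℤ.+ c ℤ.+ + 1)

  frac-of-point : Zφ
  frac-of-point = conj Y ⊖ φ^- 1

  frac-of-point≡ : negKφ (suc (label e)) ⊖ ι floor-of-point ≡ frac-of-point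
  frac-of-point≡ = trans (Zφ-≡ (identity-re (re Y) c) (identity-im c)) (cong (λ z → conj z ⊖ φ^- 1) (sym Y≡))
    where
    identity-re : ∀ (p c : ℤ) → (+ 0) ℤ.- (ℤ.- (p ℤ.+ c ℤ.+ + 1)) ≡ (p ℤ.+ c) ℤ.- ((+ 0) ℤ.- (+ 1))
    identity-re = solve-∀
    identity-im : ∀ (c : ℤ) → (ℤ.- (+ 1 ℤ.+ c)) ℤ.- (+ 0) ≡ (ℤ.- c) ℤ.- (+ 1)
    identity-im = solve-∀

  IsFloor-point : IsFloor≺ (negKφ (suc (label e))) floor-of-point
  IsFloor-point =
    ≼-by-difference {a = 0φ} {b = frac-of-point} (trans (sym (⊖-identityʳ _)) (cong (_⊖ 0φ) frac-of-point≡))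
      (≺⇒≼ (≺-by-difference {a = φ^- 1} {b = conj Y} (⊖-identityʳ _) (proj₁ (conj-low-bounds D)))) ,
    ≺-by-difference {a = frac-of-point} {b = 1φ} upper-eq (⊖-mono-≺-≼ (proj₂ (conj-low-bounds D)) (≼-refl {φ^- 1}))
    where
    identity-re : ∀ (p c : ℤ) → (ℤ.- (p ℤ.+ c ℤ.+ + 1) ℤ.+ + 1) ℤ.- (+ 0) ≡ (+ 1) ℤ.- ((p ℤ.+ c) ℤ.- ((+ 0) ℤ.- (+ 1)))
    identity-re = solve-∀
    identity-im : ∀ (c : ℤ) → (+ 0) ℤ.- (ℤ.- (+ 1 ℤ.+ c)) ≡ (+ 0) ℤ.- ((ℤ.- c) ℤ.- (+ 1))
    identity-im = solve-∀
    upper-eq : ι (floor-of-point ℤ.+ + 1) ⊖ negKφ (suc (label e)) ≡ 1φ ⊖ frac-of-point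
    upper-eq = trans (Zφ-≡ (identity-re (re Y) c) (identity-im c)) (cong (λ z → 1φ ⊖ (conj z ⊖ φ^- 1)) (sym Y≡))

FracLt≺-points : ∀ {m N N' e e'} (D : LowDigits m N e) (D' : LowDigits m N' e') →
  im (intPart e') ≡ im (intPart e) ℤ.+ + 1 → FracLt≺ (suc (label e)) (suc (label e'))
FracLt≺-points D D' im-eq = floor-of-point D , floor-of-point D' , IsFloor-point D , IsFloor-point D' ,
  ≺-respˡ (sym (frac-of-point≡ D)) (≺-respʳ (sym (frac-of-point≡ D'))
    (⊖-mono-≺-≼ (conj-low-increasing D D' im-eq) (≼-refl {φ^- 1})))

-- Sorted lists and first occurrences

module _ {A : Set} {R : A → A → Set} (R-trans : ∀ {a b c} → R a b → R b c → R a c) (R-irrefl : ∀ {a} → ¬ R a a) where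

  AllPairs-↭⇒≡ : ∀ {xs ys} → AllPairs R xs → AllPairs R ys → xs ↭ ys → xs ≡ ys
  AllPairs-↭⇒≡ {[]} {[]} _ _ _ = refl
  AllPairs-↭⇒≡ {[]} {_ ∷ _} _ _ p with ↭P.↭-length p
  ... | ()
  AllPairs-↭⇒≡ {_ ∷ _} {[]} _ _ p with ↭P.↭-length p
  ... | ()
  AllPairs-↭⇒≡ {x ∷ xs} {y ∷ ys} (x< ∷ sorted) (y< ∷ sorted') p with ↭P.∈-resp-↭ p (here refl)
  ... | here refl = cong (x ∷_) (AllPairs-↭⇒≡ sorted sorted' (↭P.drop-∷ p))
  ... | there x∈ys with ↭P.∈-resp-↭ (↭-sym p) (here refl)
  ...   | here refl = cong (x ∷_) (AllPairs-↭⇒≡ sorted sorted' (↭P.drop-∷ p))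
  ...   | there y∈xs = ⊥-elim (R-irrefl (R-trans (All.lookup x< y∈xs) (All.lookup y< x∈ys)))

  Linked-↭⇒≡ : ∀ {xs ys} → Linked R xs → Linked R ys → xs ↭ ys → xs ≡ ys
  Linked-↭⇒≡ sorted sorted' = AllPairs-↭⇒≡ (LinkedP.Linked⇒AllPairs R-trans sorted) (LinkedP.Linked⇒AllPairs R-trans sorted')

  Linked⇒Unique : ∀ {xs} → Linked R xs → Unique xs
  Linked⇒Unique sorted = AllPairs.map (λ r eq → R-irrefl (subst (R _) (sym eq) r)) (LinkedP.Linked⇒AllPairs R-trans sorted)

Unique-⊆-length⇒↭ : ∀ {A : Set} {xs ys : List A} → Unique xs → (∀ {z} → z ∈ xs → z ∈ ys) → length xs ≡ length ys → xs ↭ ys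
Unique-⊆-length⇒↭ {xs = []} {[]} _ _ _ = ↭-refl
Unique-⊆-length⇒↭ {xs = x ∷ xs} {ys} (x∉xs ∷ unique) xs⊆ys len with ∈P.∈-∃++ (xs⊆ys (here refl))
... | as , bs , refl = ↭-trans (prep x (Unique-⊆-length⇒↭ unique xs⊆as++bs len')) (↭-sym (↭P.shift x as bs))
  where
  xs⊆as++bs : ∀ {z} → z ∈ xs → z ∈ as ++ bs
  xs⊆as++bs {z} z∈xs with ∈P.∈-++⁻ as (xs⊆ys (there z∈xs))
  ... | inj₁ z∈as = ∈P.∈-++⁺ˡ z∈as
  ... | inj₂ (here refl) = ⊥-elim (All.lookup x∉xs z∈xs refl)
  ... | inj₂ (there z∈bs) = ∈P.∈-++⁺ʳ as z∈bs
  len' : length xs ≡ length (as ++ bs)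
  len' = ℕP.suc-injective (trans len (trans (ListP.length-++ as)
           (trans (ℕP.+-suc (length as) (length bs)) (cong suc (sym (ListP.length-++ as))))))

lastOf : ∀ {A : Set} → A → List A → A
lastOf x [] = x
lastOf x (y ∷ ys) = lastOf y ys

lastOf-applyUpTo : ∀ {A : Set} (g : ℕ → A) n → lastOf (g 0) (applyUpTo (λ i → g (suc i)) n) ≡ g n
lastOf-applyUpTo g zero = refl
lastOf-applyUpTo g (suc n) = lastOf-applyUpTo (λ i → g (suc i)) n

module FirstOccurrences {A B : Set} (_≟_ : DecidableEquality B) (f : A → ℤ) (w : A → B) (Ok : A → Set)
  (w≡⇒f≡ : ∀ {a b} → Ok a → Ok b → w a ≡ w b → f a ≡ f b)
  (f≡⇒w≡ : ∀ {a b} → Ok a → Ok b → f a ≡ f b → w a ≡ w b) where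

  Step : A → A → Set
  Step a b = f b ≡ f a ⊎ f b ≡ f a ℤ.+ + 1

  Inc : A → A → Set
  Inc a b = f b ≡ f a ℤ.+ + 1

  firstsFrom : ℤ → List A → List A
  firstsFrom k [] = []
  firstsFrom k (y ∷ ys) with f y ℤ.≟ k
  ... | yes _ = firstsFrom k ys
  ... | no _ = y ∷ firstsFrom (f y) ys

  firsts : List A → List A
  firsts [] = []
  firsts (x ∷ xs) = x ∷ firstsFrom (f x) xs

  firstsFrom-All : ∀ {P : A → Set} k {xs} → All P xs → All P (firstsFrom k xs)
  firstsFrom-All k {[]} [] = []
  firstsFrom-All k {y ∷ ys} (py ∷ pys) with f y ℤ.≟ k
  ... | yes _ = firstsFrom-All k pys
  ... | no _ = py ∷ firstsFrom-All (f y) pys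

  firsts-All : ∀ {P : A → Set} {xs} → All P xs → All P (firsts xs)
  firsts-All {xs = []} [] = []
  firsts-All {xs = x ∷ xs} (px ∷ pxs) = px ∷ firstsFrom-All (f x) pxs

  firstsFrom-Inc : ∀ x xs → Linked Step (x ∷ xs) → Linked Inc (x ∷ firstsFrom (f x) xs)
  firstsFrom-Inc x [] _ = [-]
  firstsFrom-Inc x (y ∷ ys) (step ∷ steps) with f y ℤ.≟ f x
  ... | yes fy≡fx = subst (λ zs → Linked Inc (x ∷ zs)) (cong (λ k → firstsFrom k ys) fy≡fx) (replace-head (firstsFrom-Inc y ys steps))
    where
    replace-head : ∀ {zs} → Linked Inc (y ∷ zs) → Linked Inc (x ∷ zs)
    replace-head [-] = [-]
    replace-head {z ∷ _} (inc ∷ incs) = subst (λ u → f z ≡ u ℤ.+ + 1) fy≡fx inc ∷ incs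
  ... | no fy≢fx = inc step ∷ firstsFrom-Inc y ys steps
    where
    inc : Step x y → Inc x y
    inc (inj₁ fy≡fx) = ⊥-elim (fy≢fx fy≡fx)
    inc (inj₂ fy≡fx+1) = fy≡fx+1

  firsts-Inc : ∀ {xs} → Linked Step xs → Linked Inc (firsts xs)
  firsts-Inc {[]} [] = []
  firsts-Inc {x ∷ xs} steps = firstsFrom-Inc x xs steps

  f-lastOf : ∀ x xs → Linked Step (x ∷ xs) → f (lastOf x xs) ≡ f x ℤ.+ + length (firstsFrom (f x) xs)
  f-lastOf x [] _ = sym (ℤP.+-identityʳ (f x))
  f-lastOf x (y ∷ ys) (step ∷ steps) with f y ℤ.≟ f x
  ... | yes fy≡fx = trans (f-lastOf y ys steps) (cong (λ k → k ℤ.+ + length (firstsFrom k ys)) fy≡fx)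
  ... | no fy≢fx = trans (f-lastOf y ys steps) (trans (cong (ℤ._+ + length (firstsFrom (f y) ys)) (inc step))
                     (ℤP.+-assoc (f x) (+ 1) (+ length (firstsFrom (f y) ys))))
    where
    inc : Step x y → Inc x y
    inc (inj₁ fy≡fx) = ⊥-elim (fy≢fx fy≡fx)
    inc (inj₂ fy≡fx+1) = fy≡fx+1

  private
    Lt : A → A → Set
    Lt a b = f a ℤ.< f b

    Inc⇒Lt : ∀ {a b} → Inc a b → Lt a b
    Inc⇒Lt {a} inc = subst (f a ℤ.<_) (sym inc) (subst (ℤ._< f a ℤ.+ + 1) (ℤP.+-identityʳ (f a)) (ℤP.+-monoʳ-< (f a) (+<+ (s≤s z≤n))))

    later-larger : ∀ y zs → Linked Inc (y ∷ zs) → All (Lt y) zs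
    later-larger y [] _ = []
    later-larger y (z ∷ zs) (inc ∷ incs) = LinkedP.Linked⇒All ℤP.<-trans (Inc⇒Lt inc) (Linked.map Inc⇒Lt incs)

  deduplicate≡firsts : ∀ {xs} → All Ok xs → Linked Step xs → deduplicate _≟_ (map w xs) ≡ map w (firsts xs)
  deduplicate≡firsts {[]} _ _ = refl
  deduplicate≡firsts {x ∷ []} _ _ = refl
  deduplicate≡firsts {x ∷ y ∷ ys} (ok-x ∷ ok-y ∷ ok-ys) (step ∷ steps) =
    cong (w x ∷_) (trans (cong (filter new?) (deduplicate≡firsts (ok-y ∷ ok-ys) steps)) (drop-repeats step))
    where
    new? = λ u → ¬? (w x ≟ u)
    T = firstsFrom (f y) ys
    T-larger : All (Lt y) T
    T-larger = later-larger y T (firstsFrom-Inc y ys steps)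
    T-new : f x ℤ.≤ f y → All (λ u → ¬ (w x ≡ u)) (map w T)
    T-new fx≤fy = AllP.map⁺ (All.zipWith (λ { (ok-z , fy<fz) w≡ → ℤP.<-irrefl (w≡⇒f≡ ok-x ok-z w≡) (ℤP.≤-<-trans fx≤fy fy<fz) })
                                          (firstsFrom-All (f y) ok-ys , T-larger))
    drop-repeats : Step x y → filter new? (map w (y ∷ T)) ≡ map w (firstsFrom (f x) (y ∷ ys))
    drop-repeats step with f y ℤ.≟ f x
    drop-repeats step | yes fy≡fx =
      trans (ListP.filter-reject new? (λ w≢ → w≢ (f≡⇒w≡ ok-x ok-y (sym fy≡fx))))
            (trans (ListP.filter-all new? (T-new (ℤP.≤-reflexive (sym fy≡fx)))) (cong (λ k → map w (firstsFrom k ys)) fy≡fx))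
    drop-repeats (inj₁ fy≡fx) | no fy≢fx = ⊥-elim (fy≢fx fy≡fx)
    drop-repeats (inj₂ fy≡fx+1) | no fy≢fx =
      trans (ListP.filter-accept new? (λ w≡ → fy≢fx (sym (w≡⇒f≡ ok-x ok-y w≡))))
            (cong (w y ∷_) (ListP.filter-all new? (T-new (ℤP.<⇒≤ (Inc⇒Lt fy≡fx+1)))))

  length-firsts : ∀ x xs → Linked Step (x ∷ xs) → f (lastOf x xs) ℤ.+ + 1 ≡ f x ℤ.+ + length (firsts (x ∷ xs))
  length-firsts x xs steps = trans (cong (ℤ._+ + 1) (f-lastOf x xs steps))
    (trans (ℤP.+-assoc (f x) (+ n) (+ 1)) (cong (λ k → f x ℤ.+ + k) (ℕP.+-comm n 1)))
    where n = length (firstsFrom (f x) xs)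

2*suc∸1≡ : ∀ m → 2 * suc m ∸ 1 ≡ suc (double m)
2*suc∸1≡ m = cong (_∸ 1) (sym (double≡2* (suc m)))

Ξ≡applyUpTo : ∀ m → Ξ (suc m) ≡ applyUpTo (λ i → suc (lucas (suc (double m))) ℕ.+ i) (lucas (suc (double (suc m))) ∸ lucas (suc (double m)))
Ξ≡applyUpTo m =
  trans (cong₂ (λ p q → map (λ i → suc (lucas p) ℕ.+ i) (upTo (lucas q ∸ lucas p))) (2*suc∸1≡ m) (cong suc (sym (double≡2* (suc m)))))
        (ListP.map-upTo _ _)

lucas-odd-< : ∀ m → lucas (suc (double m)) ℕ.< lucas (suc (double (suc m)))
lucas-odd-< m = subst (lucas (suc (double m)) ℕ.<_) (ℕP.+-comm (lucas (suc (double m))) (lucas (suc (suc (double m)))))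
  (ℕP.m<m+n (lucas (suc (double m))) (lucas-suc-pos (suc (double m))))

module LabelsOfΞ (m : ℕ) (exp : ℕ → Expansion) (is-expansion : ∀ {N} → InΞ m N → IsBasePhiExpansion N (exp N)) where

  lowDigitsOf : ∀ {N} → InΞ m N → LowDigits m N (exp N)
  lowDigitsOf N∈Ξ = lowDigits N∈Ξ (is-expansion N∈Ξ)

  key : ℕ → ℤ
  key N = im (intPart (exp N))

  word : ℕ → List Bool
  word N = βminus (exp N)

  labelOf : ℕ → ℕ
  labelOf N = label (exp N)

  open FirstOccurrences (≡-dec _≟ᵇ_) key word (InΞ m)
    (λ a b → βminus≡⇒im≡ (lowDigitsOf a) (lowDigitsOf b)) (λ a b → im≡⇒βminus≡ (lowDigitsOf a) (lowDigitsOf b))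

  L₁ = lucas (suc (double m))
  L₂ = lucas (suc (double (suc m)))
  F = fib (double (suc m))

  ξ-at : ℕ → ℕ
  ξ-at i = suc L₁ ℕ.+ i

  -- Ξ lists ξ-at 0, …, ξ-at j
  j = L₂ ∸ suc L₁

  L₂∸L₁≡ : L₂ ∸ L₁ ≡ suc j
  L₂∸L₁≡ = m<n⇒n∸m≡suc[n∸suc[m]] (lucas-odd-< m)

  ξ-at-last : ξ-at j ≡ L₂
  ξ-at-last = ℕP.m+[n∸m]≡n (lucas-odd-< m)

  ξ-at-InΞ : ∀ {i} → i ℕ.< suc j → InΞ m (ξ-at i)
  ξ-at-InΞ {i} (s≤s i≤j) = inΞ (ℕP.m≤m+n (suc L₁) i) (ℕP.≤-trans (ℕP.+-monoʳ-≤ (suc L₁) i≤j) (ℕP.≤-reflexive ξ-at-last))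

  ξ-at-Step : ∀ {i} → suc i ℕ.< suc j → Step (ξ-at i) (ξ-at (suc i))
  ξ-at-Step {i} lt = i≤j≤i+1⇒j≡i⊎j≡i+1 (im-intPart-mono D D' next) (im-intPart-step D D' next)
    where
    D = lowDigitsOf (ξ-at-InΞ (ℕP.<-trans (ℕP.n<1+n i) lt))
    D' = lowDigitsOf (ξ-at-InΞ lt)
    next = ℕP.+-suc (suc L₁) i

  ξ = applyUpTo ξ-at (suc j)

  Ξ≡ξ : Ξ (suc m) ≡ ξ
  Ξ≡ξ = trans (Ξ≡applyUpTo m) (cong (applyUpTo ξ-at) L₂∸L₁≡)

  ξ-InΞ : All (InΞ m) ξ
  ξ-InΞ = AllP.applyUpTo⁺₁ ξ-at (suc j) ξ-at-InΞ

  ξ-Step : Linked Step ξ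
  ξ-Step = LinkedP.applyUpTo⁺₁ ξ-at (suc j) ξ-at-Step

  representatives = firsts ξ

  labels : List ℕ
  labels = map (λ N → suc (labelOf N)) representatives

  labels-sorted : Linked FracLt≺ labels
  labels-sorted = go (firsts-All ξ-InΞ) (firsts-Inc ξ-Step)
    where
    go : ∀ {Ns} → All (InΞ m) Ns → Linked Inc Ns → Linked FracLt≺ (map (λ N → suc (labelOf N)) Ns)
    go [] [] = []
    go (_ ∷ []) [-] = [-]
    go (a ∷ b ∷ ok) (inc ∷ incs) = FracLt≺-points (lowDigitsOf a) (lowDigitsOf b) inc ∷ go (b ∷ ok) incs

  labels-⊆ : ∀ {k} → k ∈ labels → k ∈ oneTo F
  labels-⊆ k∈ = subst (_∈ oneTo F) (sym k≡) (∈P.∈-map⁺ suc (∈P.∈-upTo⁺ (label<fib (lowDigitsOf (All.lookup (firsts-All ξ-InΞ) N∈representatives)))))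
    where
    found = ∈P.∈-map⁻ (λ N → suc (labelOf N)) k∈
    N = proj₁ found
    N∈representatives = proj₁ (proj₂ found)
    k≡ = proj₂ (proj₂ found)

  length-representatives : length representatives ≡ F
  length-representatives = ℤP.+-injective (+-cancelˡ F₁ (begin
    F₁ ℤ.+ + length representatives   ≡⟨ sym counted ⟩
    key (ξ-at j) ℤ.+ + 1              ≡⟨ last-key ⟩
    fibℤ (suc (double (suc m)))      ≡⟨ fibℤ-rec (suc (double m)) ⟩
    + F ℤ.+ F₁                        ≡⟨ ℤP.+-comm (+ F) F₁ ⟩
    F₁ ℤ.+ + F                        ∎))
    where
    open ≡-Reasoning
    F₁ = fibℤ (suc (double m))
    D₀ = lowDigitsOf (ξ-at-InΞ (s≤s z≤n))
    Dⱼ = lowDigitsOf (ξ-at-InΞ (ℕP.n<1+n j))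
    first-key : key (ξ-at 0) ≡ F₁
    first-key = ℤP.≤-antisym (im-intPart-first D₀ (ℕP.+-identityʳ (suc L₁))) (im-intPart-lower D₀)
    last-key : key (ξ-at j) ℤ.+ + 1 ≡ fibℤ (suc (double (suc m)))
    last-key = ℤP.≤-antisym (subst (ℤ._≤ _) (ℤP.+-comm (+ 1) (key (ξ-at j))) (ℤP.i<j⇒suc[i]≤j (im-intPart-upper Dⱼ)))
                            (im-intPart-last Dⱼ ξ-at-last)
    counted : key (ξ-at j) ℤ.+ + 1 ≡ F₁ ℤ.+ + length representatives
    counted = trans (cong (λ N → key N ℤ.+ + 1) (sym (lastOf-applyUpTo ξ-at j)))
      (trans (length-firsts (ξ-at 0) (applyUpTo (λ i → ξ-at (suc i)) j) ξ-Step) (cong (ℤ._+ + length representatives) first-key))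

  labels↭oneTo : labels ↭ oneTo F
  labels↭oneTo = Unique-⊆-length⇒↭ (Linked⇒Unique FracLt≺-trans FracLt≺-irrefl labels-sorted) labels-⊆
    (trans (ListP.length-map _ representatives)
           (trans length-representatives (sym (trans (ListP.length-map suc (upTo F)) (ListP.length-upTo F)))))

  Πβ≡labels : Πβ (suc m) exp ≡ map (λ k → k ∸ 1) labels
  Πβ≡labels = begin
    Πβ (suc m) exp
      ≡⟨ cong (λ Ns → map (λ w → Zinv (dropLast2 w)) (deduplicate (≡-dec _≟ᵇ_) (map word Ns))) Ξ≡ξ ⟩
    map (λ w → Zinv (dropLast2 w)) (deduplicate (≡-dec _≟ᵇ_) (map word ξ))
      ≡⟨ cong (map (λ w → Zinv (dropLast2 w))) (deduplicate≡firsts ξ-InΞ ξ-Step) ⟩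
    map (λ w → Zinv (dropLast2 w)) (map word representatives)
      ≡⟨ sym (ListP.map-∘ representatives) ⟩
    map labelOf representatives
      ≡⟨ ListP.map-∘ representatives ⟩
    map (λ k → k ∸ 1) labels
      ∎
    where open ≡-Reasoning

theorem7p7 : (n : ℕ) → 1 ≤ n →
    (exp : ℕ → Expansion) →
    ((N : ℕ) → suc (lucas (2 * n ∸ 1)) ≤ N → N ≤ lucas (suc (2 * n)) →
      IsBasePhiExpansion N (exp N)) →
    (ks : List ℕ) → ks ↭ oneTo (fib (2 * n)) → Linked FracLt ks →
    Πβ n exp ≡ map (λ k → k ∸ 1) ks
theorem7p7 (suc m) _ exp is-expansion ks ks↭ ks-sorted = trans Πβ≡labels (cong (map (λ k → k ∸ 1)) labels≡ks)
  where
  open LabelsOfΞ m exp (λ {N} (inΞ lower upper) → is-expansion N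
    (subst (λ i → suc (lucas i) ≤ N) (sym (2*suc∸1≡ m)) lower)
    (subst (λ i → N ≤ lucas i) (cong suc (double≡2* (suc m))) upper))
  labels≡ks : labels ≡ ks
  labels≡ks = Linked-↭⇒≡ FracLt≺-trans FracLt≺-irrefl labels-sorted (Linked.map FracLt⇒FracLt≺ ks-sorted)
    (↭-trans labels↭oneTo (subst (λ i → oneTo (fib i) ↭ ks) (sym (double≡2* (suc m))) (↭-sym ks↭)))
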